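{- Let $q=p^e$ be a prime power ($p$ prime), $r$ a positive integer, and $w\geq 2$ an integer such that $w$ is relatively prime to $q^r-1$, $r$ is relatively prime to $w!$, and $w$ is not a power of $p$. Then $\Phi_w$ is an orthomorphism on $\mathrm{PG}(r-1,\mathbb{F}_q)$.
   Context: Let $\mathbb{F}=\mathbb{F}_{q^r}$, $S=\mathrm{PG}(r-1,\mathbb{F}_q)$, and fix a primitive element $z\in\mathbb{F}$. Label each point $(x_1:x_2:\cdots:x_r)$ of $S$ by the element $\sum_{i=1}^r x_i z^i\in\mathbb{F}$; each point thus has $q-1$ labels (the $\mathbb{F}_q^\ast$-multiples of one another), and each nonzero element of $\mathbb{F}$ labels exactly one point. For an integer $i$ relatively prime to $q^r-1$, the map $x\mapsto x^i$ on labels induces a well-defined bijection on the points of $S$, denoted $\Phi_i$. A cap is a set of points no three of which are collinear. A map $f$ from the points of $\mathrm{PG}(d,\mathbb{F}_q)$ to itself is an orthomorphism if it is a bijection and the image of every line is a cap. -}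

module Defs where

open import Level using (Level; _⊔_)
open import Data.Nat as ℕ using (ℕ; zero; suc)
open import Data.Fin using (Fin; toℕ)
open import Data.Product using (Σ; ∃; ∃₂; _×_; _,_; proj₁; proj₂)
open import Relation.Nullary using (¬_)
open import Relation.Binary.PropositionalEquality using (_≡_)
open import Algebra.Bundles using (CommutativeRing)
open import Algebra.Morphism.Structures using (module RingMorphisms)

module _ {c ℓ : Level} (R : CommutativeRing c ℓ) where
  open CommutativeRing R

  IsField : Set (c ⊔ ℓ)
  IsField = (0# ≉ 1#) × (∀ x → x ≉ 0# → ∃ λ y → x * y ≈ 1#)

  HasCardinality : ℕ → Set (c ⊔ ℓ)
  HasCardinality n =
    Σ (Fin n → Carrier) λ f →
      (∀ i j → f i ≈ f j → i ≡ j) × (∀ x → ∃ λ i → f i ≈ x)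

  pow : Carrier → ℕ → Carrier
  pow x zero    = 1#
  pow x (suc n) = x * pow x n

  sumFin : (n : ℕ) → (Fin n → Carrier) → Carrier
  sumFin zero    f = 0#
  sumFin (suc n) f = f Fin.zero + sumFin n (λ i → f (Fin.suc i))
    where import Data.Fin as Fin

  IsPrimitive : Carrier → Set (c ⊔ ℓ)
  IsPrimitive z = ∀ x → x ≉ 0# → ∃ λ k → x ≈ pow z k

-- Projective space PG(r-1, K): nonzero vectors in K^r up to K*-scaling

module PG {c ℓ : Level} (K : CommutativeRing c ℓ) (r : ℕ) where
  open CommutativeRing K

  Vect : Set c
  Vect = Fin r → Carrier

  Point : Set (c ⊔ ℓ)
  Point = Σ Vect λ v → ∃ λ i → v i ≉ 0#

  vec : Point → Vect
  vec = proj₁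

  _∼_ : Point → Point → Set (c ⊔ ℓ)
  P ∼ Q = ∃ λ t → (t ≉ 0#) × (∀ i → vec P i ≈ t * vec Q i)

  OnLine : Point → Point → Point → Set (c ⊔ ℓ)
  OnLine a b P = ∃₂ λ s t → ∀ i → vec P i ≈ s * vec a i + t * vec b i

  Collinear : Point → Point → Point → Set (c ⊔ ℓ)
  Collinear P Q S = ∃₂ λ a b → (¬ a ∼ b) × OnLine a b P × OnLine a b Q × OnLine a b S

  IsCap : (Point → Set (c ⊔ ℓ)) → Set (c ⊔ ℓ)
  IsCap C = ∀ P Q S → C P → C Q → C S →
            ¬ P ∼ Q → ¬ Q ∼ S → ¬ P ∼ S → ¬ Collinear P Q S

  -- A map on points given by its graph Φ (Φ P Q : "P is sent to Q").
  IsOrthomorphism : (Point → Point → Set (c ⊔ ℓ)) → Set (c ⊔ ℓ)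
  IsOrthomorphism Φ =
      (∀ P → ∃ λ Q → Φ P Q)
    × (∀ P P′ Q Q′ → Φ P Q → Φ P′ Q′ → P ∼ P′ → Q ∼ Q′)
    × (∀ P P′ Q Q′ → Φ P Q → Φ P′ Q′ → Q ∼ Q′ → P ∼ P′)
    × (∀ Q → ∃ λ P → Φ P Q)
    × (∀ a b → ¬ a ∼ b → IsCap (λ Q → ∃ λ P → OnLine a b P × Φ P Q))

module Labels {c₁ ℓ₁ c₂ ℓ₂ : Level}
  (K : CommutativeRing c₁ ℓ₁) (F : CommutativeRing c₂ ℓ₂)
  (ι : CommutativeRing.Carrier K → CommutativeRing.Carrier F)
  (z : CommutativeRing.Carrier F) (r : ℕ) where
  open PG K r
  open CommutativeRing F renaming (Carrier to FC; _≈_ to _≈F_; _*_ to _*F_)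

  label : Vect → FC
  label v = sumFin F r (λ i → ι (v i) *F pow F z (suc (toℕ i)))

  Φgraph : ℕ → Point → Point → Set ℓ₂
  Φgraph i P Q = label (vec Q) ≈F pow F (label (vec P)) i

-- Labels identify the points of PG(r-1, q) with F*/K*, and Φ_w is induced by x ↦ x^w, a bijection of F* as
-- w is prime to q^r - 1. If three distinct collinear points with labels x₁, x₂, λ₁ x₁ + λ₂ x₂ had collinear
-- images, dividing the linear relation between the w-th powers by x₁^w gives c₁ + c₂ u^w + c₃ (λ₁ + λ₂ u)^w = 0
-- with u = x₂ / x₁ ∉ K. The degree of u over K divides r (counting the subgroup K(u)* of the cyclic group F*)
-- and r is prime to w!, so the degree exceeds w and 1, u, …, u^w are independent over K. But the coefficient
-- of u^k is c₃ (w C k) λ₁^(w-k) λ₂^k, nonzero in characteristic p for 0 < k = p^s < w, where p^s ∥ w.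

module Submission where

open import Level using (Level; _⊔_; Lift; lift)
open import Algebra.Bundles using (CommutativeRing)
open import Algebra.Morphism.Structures using (module RingMorphisms)
open import Data.Nat as ℕ using (ℕ; zero; suc)
import Data.Nat.Properties as ℕ
open import Data.Maybe using (Maybe; just; nothing)
open import Relation.Nullary using (Dec; yes; no)
open import Data.Empty using (⊥; ⊥-elim)
import Relation.Binary.PropositionalEquality as ≡
open import Relation.Binary.PropositionalEquality using (_≡_; _≢_)
open import Function using (_∘_)
open import Data.Nat.Primality using (Prime)
open import Data.Nat.Coprimality using (Coprime)
open import Defs

module IntegerCoefficients {c ℓ : Level} (R : CommutativeRing c ℓ) where
  open CommutativeRing R
  open import Algebra.Properties.Ring ring
    using (-‿involutive; -0#≈0#; -‿distribˡ-*; -‿distribʳ-*; -‿+-comm)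
  open import Algebra.Properties.Semiring.Mult semiring using (_×_; ×-homo-+; ×1-homo-*)
  open import Algebra.Solver.Ring.AlmostCommutativeRing
    using (AlmostCommutativeRing; fromCommutativeRing; _-Raw-AlmostCommutative⟶_)
  open import Data.Integer as ℤ using (ℤ; +_; -[1+_]; _⊖_; _◃_)
  import Data.Integer.Properties as ℤ
  open import Data.Sign as Sign using (Sign)
  open import Relation.Binary.Reasoning.Setoid setoid

  ⟦_⟧ : ℤ → Carrier
  ⟦ + n ⟧      = n × 1#
  ⟦ -[1+ n ] ⟧ = - (suc n × 1#)

  private
    signed : Sign → Carrier → Carrier
    signed Sign.+ x = x
    signed Sign.- x = - x

    signed-cong : ∀ s {x y} → x ≈ y → signed s x ≈ signed s y
    signed-cong Sign.+ x≈y = x≈y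
    signed-cong Sign.- x≈y = -‿cong x≈y

    signed-* : ∀ s t x y → signed (s Sign.* t) (x * y) ≈ signed s x * signed t y
    signed-* Sign.+ Sign.+ x y = refl
    signed-* Sign.+ Sign.- x y = -‿distribʳ-* x y
    signed-* Sign.- Sign.+ x y = -‿distribˡ-* x y
    signed-* Sign.- Sign.- x y = begin
      x * y         ≈⟨ -‿involutive (x * y) ⟨
      - - (x * y)   ≈⟨ -‿cong (-‿distribˡ-* x y) ⟩
      - (- x * y)   ≈⟨ -‿distribʳ-* (- x) y ⟩
      - x * - y     ∎

    ⟦⟧-sign-abs : ∀ i → ⟦ i ⟧ ≈ signed (ℤ.sign i) (ℤ.∣ i ∣ × 1#)
    ⟦⟧-sign-abs (+ n)      = refl
    ⟦⟧-sign-abs -[1+ n ]   = refl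

    ⟦◃⟧ : ∀ s n → ⟦ s ◃ n ⟧ ≈ signed s (n × 1#)
    ⟦◃⟧ Sign.+ zero    = refl
    ⟦◃⟧ Sign.- zero    = sym -0#≈0#
    ⟦◃⟧ Sign.+ (suc n) = refl
    ⟦◃⟧ Sign.- (suc n) = refl

    1+x-[1+y]≈x-y : ∀ x y → (1# + x) - (1# + y) ≈ x - y
    1+x-[1+y]≈x-y x y = begin
      (1# + x) - (1# + y)       ≈⟨ +-congˡ (-‿+-comm 1# y) ⟨
      (1# + x) + (- 1# + - y)   ≈⟨ +-assoc 1# x _ ⟩
      1# + (x + (- 1# + - y))   ≈⟨ +-congˡ (+-assoc x _ _) ⟨
      1# + ((x - 1#) - y)       ≈⟨ +-congˡ (+-congʳ (+-comm x _)) ⟩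
      1# + ((- 1# + x) - y)     ≈⟨ +-congˡ (+-assoc _ x _) ⟩
      1# + (- 1# + (x - y))     ≈⟨ +-assoc _ _ _ ⟨
      (1# - 1#) + (x - y)       ≈⟨ +-congʳ (-‿inverseʳ 1#) ⟩
      0# + (x - y)              ≈⟨ +-identityˡ _ ⟩
      x - y                     ∎

    ⟦⊖⟧ : ∀ m n → ⟦ m ⊖ n ⟧ ≈ m × 1# - n × 1#
    ⟦⊖⟧ m       zero    = sym (trans (+-congˡ -0#≈0#) (+-identityʳ _))
    ⟦⊖⟧ zero    (suc n) = sym (+-identityˡ _)
    ⟦⊖⟧ (suc m) (suc n) = begin
      ⟦ suc m ⊖ suc n ⟧       ≡⟨ ≡.cong ⟦_⟧ (ℤ.[1+m]⊖[1+n]≡m⊖n m n) ⟩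
      ⟦ m ⊖ n ⟧               ≈⟨ ⟦⊖⟧ m n ⟩
      m × 1# - n × 1#         ≈⟨ 1+x-[1+y]≈x-y _ _ ⟨
      suc m × 1# - suc n × 1# ∎

  ⟦⟧-homo-+ : ∀ i j → ⟦ i ℤ.+ j ⟧ ≈ ⟦ i ⟧ + ⟦ j ⟧
  ⟦⟧-homo-+ (+ m)    (+ n)    = ×-homo-+ 1# m n
  ⟦⟧-homo-+ (+ m)    -[1+ n ] = ⟦⊖⟧ m (suc n)
  ⟦⟧-homo-+ -[1+ m ] (+ n)    = trans (⟦⊖⟧ n (suc m)) (+-comm _ _)
  ⟦⟧-homo-+ -[1+ m ] -[1+ n ] = begin
    - (suc (suc (m ℕ.+ n)) × 1#)      ≡⟨ ≡.cong (λ k → - (suc k × 1#)) (ℕ.+-suc m n) ⟨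
    - ((suc m ℕ.+ suc n) × 1#)        ≈⟨ -‿cong (×-homo-+ 1# (suc m) (suc n)) ⟩
    - (suc m × 1# + suc n × 1#)       ≈⟨ -‿+-comm _ _ ⟨
    - (suc m × 1#) + - (suc n × 1#)   ∎

  ⟦⟧-homo-* : ∀ i j → ⟦ i ℤ.* j ⟧ ≈ ⟦ i ⟧ * ⟦ j ⟧
  ⟦⟧-homo-* i j = begin
    ⟦ s ◃ (ℤ.∣ i ∣ ℕ.* ℤ.∣ j ∣) ⟧                        ≈⟨ ⟦◃⟧ s (ℤ.∣ i ∣ ℕ.* ℤ.∣ j ∣) ⟩
    signed s ((ℤ.∣ i ∣ ℕ.* ℤ.∣ j ∣) × 1#)                ≈⟨ signed-cong s (×1-homo-* ℤ.∣ i ∣ ℤ.∣ j ∣) ⟩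
    signed s ((ℤ.∣ i ∣ × 1#) * (ℤ.∣ j ∣ × 1#))           ≈⟨ signed-* (ℤ.sign i) (ℤ.sign j) _ _ ⟩
    signed (ℤ.sign i) (ℤ.∣ i ∣ × 1#) * signed (ℤ.sign j) (ℤ.∣ j ∣ × 1#)
                                                         ≈⟨ *-cong (⟦⟧-sign-abs i) (⟦⟧-sign-abs j) ⟨
    ⟦ i ⟧ * ⟦ j ⟧                                         ∎
    where s = ℤ.sign i Sign.* ℤ.sign j

  ⟦⟧-homo-neg : ∀ i → ⟦ ℤ.- i ⟧ ≈ - ⟦ i ⟧
  ⟦⟧-homo-neg (+ zero)  = sym -0#≈0#
  ⟦⟧-homo-neg (+ suc n) = refl
  ⟦⟧-homo-neg -[1+ n ]  = sym (-‿involutive _)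

  ringᴬ : AlmostCommutativeRing c ℓ
  ringᴬ = fromCommutativeRing R

  ℤ⟶R : ℤ.+-*-rawRing -Raw-AlmostCommutative⟶ ringᴬ
  ℤ⟶R = record
    { ⟦_⟧ = ⟦_⟧ ; +-homo = ⟦⟧-homo-+ ; *-homo = ⟦⟧-homo-* ; -‿homo = ⟦⟧-homo-neg
    ; 0-homo = refl ; 1-homo = +-identityʳ 1# }

  _≟ᶜ_ : ∀ i j → Maybe (⟦ i ⟧ ≈ ⟦ j ⟧)
  i ≟ᶜ j with i ℤ.≟ j
  ... | yes ≡.refl = just refl
  ... | no _       = nothing

  open import Algebra.Solver.Ring ℤ.+-*-rawRing ringᴬ ℤ⟶R _≟ᶜ_ public
    using (solve; _:=_; _:+_; _:*_; _:-_; :-_; con)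

module Arithmetic where
  open import Data.Nat
  open import Data.Nat.Properties
  open import Data.Nat.Divisibility
  open import Data.Nat.Primality using (Prime; prime⇒nonTrivial; prime⇒irreducible; euclidsLemma)
  open import Data.Nat.Coprimality using (Coprime; coprime-Bézout)
  open import Data.Nat.GCD using (module Bézout)
  open import Data.Nat.Combinatorics using (_C_; nCk+nC[k+1]≡[n+1]C[k+1]; k>n⇒nCk≡0; nC1≡n)
  open import Data.Nat.Induction using (<-wellFounded)
  open import Data.Nat.Tactic.RingSolver using (solve-∀)
  open import Data.Fin using (Fin; toℕ; fromℕ; fromℕ<)
  import Data.Fin.Properties as Fin
  open import Data.Product using (∃; ∃₂; _×_; _,_)
  open import Data.Sum using (inj₁; inj₂)
  open import Data.Empty using (⊥-elim)
  open import Induction.WellFounded using (Acc; acc)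
  open import Relation.Nullary using (¬_; ¬?; yes; no)
  open import Relation.Nullary.Decidable using (decidable-stable)
  open import Relation.Unary using (Decidable)
  open import Relation.Binary.PropositionalEquality
  open ≡-Reasoning

  m∣n! : ∀ {m n} → 1 ≤ m → m ≤ n → m ∣ n !
  m∣n! {suc k} _ m≤n = ∣-trans (m∣m*n (k !)) (m≤n⇒m!∣n! m≤n)

  prime≥2 : ∀ {p} → Prime p → 2 ≤ p
  prime≥2 {p} pp = nonTrivial⇒n>1 p {{prime⇒nonTrivial pp}}

  prime^e≥2 : ∀ {p e} → Prime p → 1 ≤ e → 2 ≤ p ^ e
  prime^e≥2 {p} {suc e} pp _ = ≤-trans (prime≥2 pp) (m≤m*n p (p ^ e))
    where
    instance
      p≢0 : NonZero p
      p≢0 = nonTrivial⇒nonZero p {{prime⇒nonTrivial pp}}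
      p^e≢0 : NonZero (p ^ e)
      p^e≢0 = >-nonZero (m^n>0 p e)

  prime∧∤⇒coprime : ∀ {p m} → Prime p → p ∤ m → Coprime p m
  prime∧∤⇒coprime pp p∤m (d∣p , d∣m) with prime⇒irreducible pp d∣p
  ... | inj₁ d≡1  = d≡1
  ... | inj₂ refl = ⊥-elim (p∤m d∣m)

  -- Bézout gives 1 + y n = x w or 1 + x w = y n; in the second case x (n - 1) is an inverse of w.
  coprime⇒invertible-mod : ∀ {w n} → Coprime w n → 1 ≤ n → ∃ λ e → ∃₂ λ k l → w * e + k * n ≡ 1 + l * n
  coprime⇒invertible-mod {w} {n} w⊥n n≥1 with coprime-Bézout w⊥n
  ... | Bézout.+- x y eq = x , 0 , y , trans (+-identityʳ (w * x)) (trans (*-comm w x) (sym eq))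
  ... | Bézout.-+ x y eq = x * pred n , y , w * x , (begin
    w * (x * pred n) + y * n              ≡⟨ cong (w * (x * pred n) +_) eq ⟨
    w * (x * pred n) + (1 + x * w)        ≡⟨ regroup w x (pred n) ⟩
    1 + w * x * suc (pred n)              ≡⟨ cong (λ m → 1 + w * x * m) (suc-pred n) ⟩
    1 + w * x * n                         ∎)
    where
    instance _ = >-nonZero n≥1
    regroup : ∀ w x m → w * (x * m) + (1 + x * w) ≡ 1 + w * x * suc m
    regroup = solve-∀

  ∃-least : ∀ {a} {P : ℕ → Set a} → Decidable P → ∀ {n} → P n →
            ∃ λ m → P m × (∀ {k} → k < m → ¬ P k)
  ∃-least {P = P} P? {n} Pn
    with Fin.¬∀⟶∃¬-smallest (suc n) (λ i → ¬ P (toℕ i)) (λ i → ¬? (P? (toℕ i)))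
           (λ ¬P → ¬P (fromℕ n) (subst P (sym (Fin.toℕ-fromℕ n)) Pn))
  ... | i , ¬¬Pi , below = toℕ i , decidable-stable (P? (toℕ i)) ¬¬Pi , ¬Pk
    where
    ¬Pk : ∀ {k} → k < toℕ i → ¬ P k
    ¬Pk k<i = subst (λ k → ¬ P k) (trans (Fin.toℕ-inject (fromℕ< k<i)) (Fin.toℕ-fromℕ< k<i))
                    (below (fromℕ< k<i))

  q^m≤q^n⇒m≤n : ∀ {q m n} → 2 ≤ q → q ^ m ≤ q ^ n → m ≤ n
  q^m≤q^n⇒m≤n {q} q≥2 q^m≤q^n = ≮⇒≥ (λ n<m → <⇒≱ (^-monoʳ-< q q≥2 n<m) q^m≤q^n)

  q^n∸1≡0⇒n≡0 : ∀ {q} n → 2 ≤ q → q ^ n ∸ 1 ≡ 0 → n ≡ 0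
  q^n∸1≡0⇒n≡0 zero    _   _ = refl
  q^n∸1≡0⇒n≡0 (suc n) q≥2 e = ⊥-elim (<⇒≱ (^-monoʳ-< _ q≥2 (z<s {n})) (m∸n≡0⇒m≤n e))

  -- The Euclidean step: q^(m+k) - 1 = q^k (q^m - 1) + (q^k - 1).
  [q^m∸1]∣[q^n∸1]⇒m∣n : ∀ {q m} n → 2 ≤ q → 1 ≤ m → (q ^ m ∸ 1) ∣ (q ^ n ∸ 1) → m ∣ n
  [q^m∸1]∣[q^n∸1]⇒m∣n {q} {m} n q≥2 m≥1 = go n (<-wellFounded n)
    where
    instance _ = >-nonZero (≤-trans (s≤s z≤n) q≥2)

    split : ∀ k → q ^ (m + k) ∸ 1 ≡ q ^ k * (q ^ m ∸ 1) + (q ^ k ∸ 1)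
    split k = begin
      q ^ (m + k) ∸ 1                  ≡⟨ cong (_∸ 1) (^-distribˡ-+-* q m k) ⟩
      q ^ m * q ^ k ∸ 1                ≡⟨ decomp (q ^ m) (q ^ k) (m^n>0 q m) (m^n>0 q k) ⟩
      q ^ k * (q ^ m ∸ 1) + (q ^ k ∸ 1) ∎
      where
      decomp : ∀ a b → 1 ≤ a → 1 ≤ b → a * b ∸ 1 ≡ b * (a ∸ 1) + (b ∸ 1)
      decomp (suc a) (suc b) _ _ = ring a b
        where
        ring : ∀ a b → b + a * suc b ≡ suc b * a + b
        ring = solve-∀

    go : ∀ n → Acc _<_ n → (q ^ m ∸ 1) ∣ (q ^ n ∸ 1) → m ∣ n
    go n _ d with n <? m
    ... | yes n<m = subst (m ∣_) (sym (q^n∸1≡0⇒n≡0 n q≥2 q^n∸1≡0)) (m ∣0)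
      where
      q^n∸1≡0 : q ^ n ∸ 1 ≡ 0
      q^n∸1≡0 = m∣n∧n<m⇒n≡0 d (∸-monoˡ-< (^-monoʳ-< q q≥2 n<m) (m^n>0 q n))
        where
        m∣n∧n<m⇒n≡0 : ∀ {d x} → d ∣ x → x < d → x ≡ 0
        m∣n∧n<m⇒n≡0 {x = zero}  _   _   = refl
        m∣n∧n<m⇒n≡0 {x = suc x} d∣x x<d = ⊥-elim (<⇒≱ x<d (∣⇒≤ d∣x))
    go n (acc rec) d | no n≮m = subst (m ∣_) m+k≡n (∣m∣n⇒∣m+n ∣-refl (go k (rec k<n) d′))
      where
      k = n ∸ m
      m+k≡n : m + k ≡ n
      m+k≡n = m+[n∸m]≡n (≮⇒≥ n≮m)
      k<n : k < n
      k<n = ∸-monoʳ-< {n} {m} {0} m≥1 (≮⇒≥ n≮m)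
      d′ : (q ^ m ∸ 1) ∣ (q ^ k ∸ 1)
      d′ = ∣m+n∣m⇒∣n (subst ((q ^ m ∸ 1) ∣_) (trans (cong (λ x → q ^ x ∸ 1) (sym m+k≡n)) (split k)) d)
                     (n∣m*n (q ^ k))

  [1+k]*[1+n]C[1+k]≡[1+n]*nCk : ∀ n k → suc k * (suc n C suc k) ≡ suc n * (n C k)
  [1+k]*[1+n]C[1+k]≡[1+n]*nCk zero    zero    = refl
  [1+k]*[1+n]C[1+k]≡[1+n]*nCk zero    (suc k) = begin
    suc (suc k) * (1 C suc (suc k)) ≡⟨ cong (suc (suc k) *_) (k>n⇒nCk≡0 (s<s (z<s {k}))) ⟩
    suc (suc k) * 0                 ≡⟨ *-zeroʳ (suc (suc k)) ⟩
    0                               ≡⟨ cong (1 *_) (k>n⇒nCk≡0 (z<s {k})) ⟨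
    1 * (0 C suc k)                 ∎
  [1+k]*[1+n]C[1+k]≡[1+n]*nCk (suc n) zero    = trans (+-identityʳ _) (trans (nC1≡n (suc (suc n))) (sym (*-identityʳ _)))
  [1+k]*[1+n]C[1+k]≡[1+n]*nCk (suc n) (suc k) = begin
    suc (suc k) * (suc (suc n) C suc (suc k))
      ≡⟨ cong (suc (suc k) *_) (nCk+nC[k+1]≡[n+1]C[k+1] (suc n) (suc k)) ⟨
    suc (suc k) * (A + B)
      ≡⟨ distrib A B k ⟩
    (suc k * A + A) + suc (suc k) * B
      ≡⟨ cong₂ (λ x y → (x + A) + y) ([1+k]*[1+n]C[1+k]≡[1+n]*nCk n k) ([1+k]*[1+n]C[1+k]≡[1+n]*nCk n (suc k)) ⟩
    (suc n * (n C k) + A) + suc n * (n C suc k)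
      ≡⟨ regroup (n C k) (n C suc k) A n ⟩
    suc n * (n C k + n C suc k) + A
      ≡⟨ cong (λ x → suc n * x + A) (nCk+nC[k+1]≡[n+1]C[k+1] n k) ⟩
    suc n * A + A
      ≡⟨ +-comm (suc n * A) A ⟩
    suc (suc n) * A ∎
    where
    A = suc n C suc k
    B = suc n C suc (suc k)
    distrib : ∀ x y k → suc (suc k) * (x + y) ≡ (suc k * x + x) + suc (suc k) * y
    distrib = solve-∀
    regroup : ∀ a b c n → (suc n * a + c) + suc n * b ≡ suc n * (a + b) + c
    regroup = solve-∀

  p-power-split : ∀ {p} → 2 ≤ p → ∀ {m} → 1 ≤ m → ∃₂ λ s m′ → m ≡ p ^ s * m′ × p ∤ m′
  p-power-split {p} p≥2 {m} m≥1 = go m (<-wellFounded m) m≥1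
    where
    go : ∀ m → Acc _<_ m → 1 ≤ m → ∃₂ λ s m′ → m ≡ p ^ s * m′ × p ∤ m′
    go m (acc rec) m≥1 with p ∣? m
    ... | no p∤m = 0 , m , sym (+-identityʳ m) , p∤m
    ... | yes (divides k m≡k*p) with go k (rec k<m) k≥1
      where
      k≥1 : 1 ≤ k
      k≥1 = n≢0⇒n>0 (λ k≡0 → <⇒≱ m≥1 (≤-reflexive (trans m≡k*p (cong (_* p) k≡0))))
      k<m : k < m
      k<m = subst (k <_) (sym m≡k*p) (m<m*n k p {{>-nonZero k≥1}} p≥2)
    ... | s , m′ , k≡p^s*m′ , p∤m′ =
      suc s , m′ , trans m≡k*p (trans (cong (_* p) k≡p^s*m′) (rotate (p ^ s) m′ p)) , p∤m′
      where
      rotate : ∀ a b p → a * b * p ≡ p * a * b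
      rotate = solve-∀

  p^s∣m*n∧p∤n⇒p^s∣m : ∀ {p} → Prime p → ∀ s {m n} → p ^ s ∣ m * n → p ∤ n → p ^ s ∣ m
  p^s∣m*n∧p∤n⇒p^s∣m pp zero    {m} _ _ = 1∣ m
  p^s∣m*n∧p∤n⇒p^s∣m {p} pp (suc s) {m} {n} d p∤n
    with euclidsLemma m n pp (∣-trans (m∣m*n (p ^ s)) d)
  ... | inj₂ p∣n = ⊥-elim (p∤n p∣n)
  ... | inj₁ (divides m′ refl) =
    subst (p * p ^ s ∣_) (*-comm p m′) (*-monoʳ-∣ p (p^s∣m*n∧p∤n⇒p^s∣m pp s (*-cancelˡ-∣ p d′) p∤n))
    where
    instance _ = nonTrivial⇒nonZero p {{prime⇒nonTrivial pp}}
    d′ : p * p ^ s ∣ p * (m′ * n)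
    d′ = subst (p * p ^ s ∣_) (rotate m′ p n) d
      where
      rotate : ∀ a b c → a * b * c ≡ b * (a * c)
      rotate = solve-∀

  -- Absorption (j+1) (n+1 C j+1) = (n+1) (n C j) and p^s ∣ n+1 give p ∣ n+1 C j+1 below p^s; Pascal finishes.
  p∤nCj : ∀ {p} → Prime p → ∀ s {n} → p ^ s ∣ suc n → ∀ j → j < p ^ s → p ∤ n C j
  p∤nCj pp s {n} p^s∣1+n zero    _       p∣1 = <⇒≱ (prime≥2 pp) (≤-reflexive (∣1⇒≡1 p∣1))
  p∤nCj {p} pp s {n} p^s∣1+n (suc j) 1+j<p^s p∣nC[1+j] =
    p∤nCj pp s p^s∣1+n j (<-trans (n<1+n j) 1+j<p^s)
      (∣m+n∣m⇒∣n (subst (p ∣_) (sym pascal) p∣[1+n]C[1+j]) p∣nC[1+j])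
    where
    pascal : n C suc j + n C j ≡ suc n C suc j
    pascal = trans (+-comm (n C suc j) (n C j)) (nCk+nC[k+1]≡[n+1]C[k+1] n j)
    p∣[1+n]C[1+j] : p ∣ suc n C suc j
    p∣[1+n]C[1+j] with p ∣? suc n C suc j
    ... | yes p∣ = p∣
    ... | no  p∤ = ⊥-elim (<⇒≱ 1+j<p^s (∣⇒≤ (p^s∣m*n∧p∤n⇒p^s∣m pp s p^s∣[1+j]*[1+n]C[1+j] p∤)))
      where
      p^s∣[1+j]*[1+n]C[1+j] : p ^ s ∣ suc j * (suc n C suc j)
      p^s∣[1+j]*[1+n]C[1+j] = subst (p ^ s ∣_) (sym ([1+k]*[1+n]C[1+k]≡[1+n]*nCk n j)) (∣m⇒∣m*n (n C j) p^s∣1+n)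

  -- Writing w = p^s w′ with p ∤ w′, the coefficient w C p^s is prime to p (a case of Lucas' theorem).
  ∃[k]p∤wCk : ∀ {p w} → Prime p → 2 ≤ w → ¬ (∃ λ s → w ≡ p ^ s) →
              ∃ λ k → 0 < k × k < w × p ∤ w C k
  ∃[k]p∤wCk {p} {suc w-1} pp w≥2 w≢p^s
    with p-power-split (prime≥2 pp) (≤-trans (s≤s z≤n) w≥2)
  ... | s , w′ , w≡v*w′ , p∤w′ = v , v>0 , v<w , p∤wCv
    where
    w = suc w-1
    v = p ^ s
    instance
      p≢0 : NonZero p
      p≢0 = nonTrivial⇒nonZero p {{prime⇒nonTrivial pp}}
    v>0 : 0 < v
    v>0 = m^n>0 p s
    instance
      v≢0 : NonZero v
      v≢0 = >-nonZero v>0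
    w′≥2 : 2 ≤ w′
    w′≥2 = ≥2 w′ w≡v*w′
      where
      ≥2 : ∀ m → w ≡ v * m → 2 ≤ m
      ≥2 0             w≡0   = ⊥-elim (1+n≢0 (trans w≡0 (*-zeroʳ v)))
      ≥2 1             w≡v*1 = ⊥-elim (w≢p^s (s , trans w≡v*1 (*-identityʳ v)))
      ≥2 (suc (suc _)) _     = s≤s (s≤s z≤n)
    v<w : v < w
    v<w = subst (v <_) (sym w≡v*w′) (subst (_< v * w′) (*-identityʳ v) (*-monoʳ-< v w′≥2))
    v∣w : v ∣ w
    v∣w = divides w′ (trans w≡v*w′ (*-comm v w′))
    wCv≡w′*[w-1]C[v-1] : w C v ≡ w′ * (w-1 C pred v)
    wCv≡w′*[w-1]C[v-1] = *-cancelˡ-≡ _ _ v (begin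
      v * (w C v)                          ≡⟨ cong (λ x → x * (w C x)) (suc-pred v) ⟨
      suc (pred v) * (w C suc (pred v))    ≡⟨ [1+k]*[1+n]C[1+k]≡[1+n]*nCk w-1 (pred v) ⟩
      w * (w-1 C pred v)                   ≡⟨ cong (_* (w-1 C pred v)) w≡v*w′ ⟩
      v * w′ * (w-1 C pred v)              ≡⟨ *-assoc v w′ _ ⟩
      v * (w′ * (w-1 C pred v))            ∎)
    p∤wCv : p ∤ w C v
    p∤wCv p∣wCv with euclidsLemma w′ (w-1 C pred v) pp (subst (p ∣_) wCv≡w′*[w-1]C[v-1] p∣wCv)
    ... | inj₁ p∣w′ = p∤w′ p∣w′
    ... | inj₂ p∣   = p∤nCj pp s v∣w (pred v) (subst (pred v <_) (suc-pred v) (n<1+n (pred v))) p∣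

module RingProperties {c ℓ : Level} (R : CommutativeRing c ℓ) where
  open CommutativeRing R
  open import Algebra.Properties.Ring ring public using (-0#≈0#; x∙y⁻¹≈ε⇒x≈y)
  open import Algebra.Properties.Semiring.Exp semiring public using (_^_; ^-congˡ; ^-congʳ; ^-homo-*; ^-assocʳ)
  open import Algebra.Properties.CommutativeSemiring.Exp commutativeSemiring public using (^-distrib-*)
  open import Algebra.Properties.Semiring.Sum semiring public
    using (sum; sum-cong-≋; ∑-distrib-+; *-distribˡ-sum; sum-init-last; sum-remove; sum-replicate-zero)
  open import Data.Fin using (Fin; punchIn)
  open import Data.Fin.Properties using (punchInᵢ≢i)
  open import Relation.Binary.Reasoning.Setoid setoid

  pow≡^ : ∀ x n → pow R x n ≡ x ^ n
  pow≡^ x zero    = ≡.refl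
  pow≡^ x (suc n) = ≡.cong (x *_) (pow≡^ x n)

  sumFin≡sum : ∀ n (f : Fin n → Carrier) → sumFin R n f ≡ sum f
  sumFin≡sum zero    f = ≡.refl
  sumFin≡sum (suc n) f = ≡.cong (f Fin.zero +_) (sumFin≡sum n (λ i → f (Fin.suc i)))

  1^n≈1 : ∀ n → 1# ^ n ≈ 1#
  1^n≈1 zero    = refl
  1^n≈1 (suc n) = trans (*-identityˡ _) (1^n≈1 n)

  ^-periodic : ∀ {x n} → x ^ n ≈ 1# → ∀ k l → x ^ (k ℕ.+ l ℕ.* n) ≈ x ^ k
  ^-periodic {x} {n} x^n≈1 k l = begin
    x ^ (k ℕ.+ l ℕ.* n)      ≈⟨ ^-homo-* x k (l ℕ.* n) ⟩
    x ^ k * x ^ (l ℕ.* n)    ≈⟨ *-congˡ (^-congʳ x (ℕ.*-comm l n)) ⟩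
    x ^ k * x ^ (n ℕ.* l)    ≈⟨ *-congˡ (^-assocʳ x n l) ⟨
    x ^ k * (x ^ n) ^ l      ≈⟨ *-congˡ (trans (^-congˡ l x^n≈1) (1^n≈1 l)) ⟩
    x ^ k * 1#               ≈⟨ *-identityʳ _ ⟩
    x ^ k                    ∎

  ^-cong-mod : ∀ {x n} → x ^ n ≈ 1# → ∀ {a b} k l → a ℕ.+ k ℕ.* n ≡ b ℕ.+ l ℕ.* n → x ^ a ≈ x ^ b
  ^-cong-mod x^n≈1 {a} {b} k l eq =
    trans (sym (^-periodic x^n≈1 a k)) (trans (^-congʳ _ eq) (^-periodic x^n≈1 b l))

  sum-zero : ∀ {n} (f : Fin n → Carrier) → (∀ i → f i ≈ 0#) → sum f ≈ 0#
  sum-zero {n} f f≈0 = trans (sum-cong-≋ f≈0) (sum-replicate-zero n)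

  sum-δ : ∀ {n} (f : Fin (suc n) → Carrier) i → (∀ j → j ≢ i → f j ≈ 0#) → sum f ≈ f i
  sum-δ f i f≈0 = begin
    sum f                       ≈⟨ sum-remove f ⟩
    f i + sum (f ∘ punchIn i)   ≈⟨ +-congˡ (sum-zero _ (λ j → f≈0 (punchIn i j) (punchInᵢ≢i i j))) ⟩
    f i + 0#                    ≈⟨ +-identityʳ (f i) ⟩
    f i                         ∎

  -‿distrib-sum : ∀ {n} (f : Fin n → Carrier) → sum (λ i → - f i) ≈ - sum f
  -‿distrib-sum {zero}  f = sym -0#≈0#
  -‿distrib-sum {suc n} f = trans (+-congˡ (-‿distrib-sum (f ∘ Fin.suc))) (-‿+-comm (f Fin.zero) _)
    where open import Algebra.Properties.Ring ring using (-‿+-comm)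

module FieldProperties {c ℓ : Level} (R : CommutativeRing c ℓ) (isField : IsField R) where
  open CommutativeRing R
  open RingProperties R using (_^_)
  open import Data.Product using (proj₁; proj₂)
  open import Relation.Binary.Reasoning.Setoid setoid

  1≉0 : 1# ≉ 0#
  1≉0 1≈0 = proj₁ isField (sym 1≈0)

  inv : ∀ x → x ≉ 0# → Carrier
  inv x x≉0 = proj₁ (proj₂ isField x x≉0)

  inverseʳ : ∀ x (x≉0 : x ≉ 0#) → x * inv x x≉0 ≈ 1#
  inverseʳ x x≉0 = proj₂ (proj₂ isField x x≉0)

  inverseˡ : ∀ x (x≉0 : x ≉ 0#) → inv x x≉0 * x ≈ 1#
  inverseˡ x x≉0 = trans (*-comm _ _) (inverseʳ x x≉0)

  *-cancelˡ : ∀ {x y z} → x ≉ 0# → x * y ≈ x * z → y ≈ z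
  *-cancelˡ {x} {y} {z} x≉0 xy≈xz = begin
    y                     ≈⟨ *-identityˡ y ⟨
    1# * y                ≈⟨ *-congʳ (inverseˡ x x≉0) ⟨
    (inv x x≉0 * x) * y   ≈⟨ *-assoc _ _ _ ⟩
    inv x x≉0 * (x * y)   ≈⟨ *-congˡ xy≈xz ⟩
    inv x x≉0 * (x * z)   ≈⟨ *-assoc _ _ _ ⟨
    (inv x x≉0 * x) * z   ≈⟨ *-congʳ (inverseˡ x x≉0) ⟩
    1# * z                ≈⟨ *-identityˡ z ⟩
    z                     ∎

  x≉0∧xy≈0⇒y≈0 : ∀ {x y} → x ≉ 0# → x * y ≈ 0# → y ≈ 0#
  x≉0∧xy≈0⇒y≈0 {x} x≉0 xy≈0 = *-cancelˡ x≉0 (trans xy≈0 (sym (zeroʳ x)))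

  *-≉0 : ∀ {x y} → x ≉ 0# → y ≉ 0# → x * y ≉ 0#
  *-≉0 x≉0 y≉0 xy≈0 = y≉0 (x≉0∧xy≈0⇒y≈0 x≉0 xy≈0)

  ^-≉0 : ∀ {x} n → x ≉ 0# → x ^ n ≉ 0#
  ^-≉0 zero    _   = 1≉0
  ^-≉0 (suc n) x≉0 = *-≉0 x≉0 (^-≉0 n x≉0)

  inv-≉0 : ∀ x (x≉0 : x ≉ 0#) → inv x x≉0 ≉ 0#
  inv-≉0 x x≉0 inv≈0 = 1≉0 (trans (sym (inverseʳ x x≉0)) (trans (*-congˡ inv≈0) (zeroʳ x)))

module FiniteRing {c ℓ : Level} (R : CommutativeRing c ℓ) {n : ℕ} (card : HasCardinality R n) where
  open CommutativeRing R
  open RingProperties R using (sum; sum-cong-≋; ∑-distrib-+)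
  open IntegerCoefficients R using (solve; _:=_; _:+_; _:-_)
  open import Algebra.Properties.CommutativeMonoid.Sum +-commutativeMonoid using (sum-permute; sum-replicate)
  open import Algebra.Properties.Semiring.Mult semiring using (_×_)
  open import Data.Fin.Permutation using (Permutation; permutation)
  open import Relation.Binary.Reasoning.Setoid setoid
  open import Data.Nat using (_^_)
  open import Data.Fin as Fin using (Fin; combine)
  import Data.Fin.Properties as Fin
  open import Data.Product using (∃; _,_; proj₁; proj₂)
  open import Data.Sum using (_⊎_; inj₁; inj₂)
  open import Relation.Nullary.Decidable using (map′)

  enum : Fin n → Carrier
  enum = proj₁ card

  enum-injective : ∀ i j → enum i ≈ enum j → i ≡ j
  enum-injective = proj₁ (proj₂ card)

  index : Carrier → Fin n
  index x = proj₁ (proj₂ (proj₂ card) x)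

  enum-index : ∀ x → enum (index x) ≈ x
  enum-index x = proj₂ (proj₂ (proj₂ card) x)

  index-cong : ∀ {x y} → x ≈ y → index x ≡ index y
  index-cong {x} {y} x≈y = enum-injective _ _ (trans (enum-index x) (trans x≈y (sym (enum-index y))))

  index-injective : ∀ {x y} → index x ≡ index y → x ≈ y
  index-injective {x} {y} eq = trans (sym (enum-index x)) (trans (reflexive (≡.cong enum eq)) (enum-index y))

  index-enum : ∀ i → index (enum i) ≡ i
  index-enum i = enum-injective _ _ (enum-index (enum i))

  infix 4 _≟_ _≋_

  _≟_ : ∀ x y → Dec (x ≈ y)
  x ≟ y = map′ index-injective index-cong (index x Fin.≟ index y)

  zero-or-nonzero : ∀ {m} (v : Fin m → Carrier) → (∀ i → v i ≈ 0#) ⊎ ∃ λ i → v i ≉ 0#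
  zero-or-nonzero {m} v with Fin.all? (λ i → v i ≟ 0#)
  ... | yes v≈0 = inj₁ v≈0
  ... | no  v≉0 = inj₂ (Fin.¬∀⟶∃¬ m _ (λ i → v i ≟ 0#) v≉0)

  _≋_ : ∀ {m} → (Fin m → Carrier) → (Fin m → Carrier) → Set ℓ
  u ≋ v = ∀ i → u i ≈ v i

  private
    funToFin-cong : ∀ {m k} {f g : Fin m → Fin k} → (∀ i → f i ≡ g i) → Fin.funToFin f ≡ Fin.funToFin g
    funToFin-cong {zero}  _   = ≡.refl
    funToFin-cong {suc m} f≗g = ≡.cong₂ combine (f≗g Fin.zero) (funToFin-cong (f≗g ∘ Fin.suc))

  encode : ∀ {m} → (Fin m → Carrier) → Fin (n ^ m)
  encode v = Fin.funToFin (index ∘ v)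

  decode : ∀ {m} → Fin (n ^ m) → Fin m → Carrier
  decode i = enum ∘ Fin.finToFun i

  decode-encode : ∀ {m} (v : Fin m → Carrier) → decode (encode v) ≋ v
  decode-encode v i = trans (reflexive (≡.cong enum (Fin.finToFun-funToFin (index ∘ v) i))) (enum-index (v i))

  decode-injective : ∀ {m} {i j : Fin (n ^ m)} → decode {m} i ≋ decode j → i ≡ j
  decode-injective {m} {i} {j} eq = ≡.trans (≡.sym (Fin.funToFin-finToFin {m} i))
    (≡.trans (funToFin-cong (λ k → enum-injective _ _ (eq k))) (Fin.funToFin-finToFin {m} j))

  encode-injective : ∀ {m} {u v : Fin m → Carrier} → encode u ≡ encode v → u ≋ v
  encode-injective {u = u} {v} eq i =
    trans (sym (decode-encode u i)) (trans (reflexive (≡.cong (λ k → decode k i) eq)) (decode-encode v i))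

  ∃? : ∀ {p m} {P : (Fin m → Carrier) → Set p} → (∀ v → Dec (P v)) →
       (∀ {u v} → u ≋ v → P u → P v) → Dec (∃ P)
  ∃? {P = P} P? resp =
    map′ (λ (i , Pi) → decode i , Pi)
         (λ (v , Pv) → encode v , resp (λ i → sym (decode-encode v i)) Pv)
         (Fin.any? (λ i → P? (decode i)))

  -- Translation by 1 permutes the elements, so their sum s satisfies s ≈ s + n × 1.
  n×1≈0 : n × 1# ≈ 0#
  n×1≈0 = begin
    n × 1#                  ≈⟨ solve 2 (λ s a → a := (s :+ a) :- s) refl s (n × 1#) ⟩
    (s + n × 1#) - s        ≈⟨ +-congʳ s≈s+n×1 ⟨
    s - s                   ≈⟨ -‿inverseʳ s ⟩
    0#                      ∎
    where
    s = sum enum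
    shift : Permutation n n
    shift = permutation (λ i → index (enum i + 1#)) (λ i → index (enum i - 1#))
      (λ i → ≡.trans (index-cong (trans (+-congʳ (enum-index _)) (x-1+1≈x (enum i)))) (index-enum i))
      (λ i → ≡.trans (index-cong (trans (+-congʳ (enum-index _)) (x+1-1≈x (enum i)))) (index-enum i))
      where
      x-1+1≈x : ∀ x → (x - 1#) + 1# ≈ x
      x-1+1≈x x = solve 2 (λ x o → (x :- o) :+ o := x) refl x 1#
      x+1-1≈x : ∀ x → (x + 1#) - 1# ≈ x
      x+1-1≈x x = solve 2 (λ x o → (x :+ o) :- o := x) refl x 1#
    s≈s+n×1 : s ≈ s + n × 1#
    s≈s+n×1 = begin
      s                                    ≈⟨ sum-permute enum shift ⟩
      sum (λ i → enum (index (enum i + 1#))) ≈⟨ sum-cong-≋ (λ i → enum-index (enum i + 1#)) ⟩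
      sum (λ i → enum i + 1#)              ≈⟨ ∑-distrib-+ enum (λ _ → 1#) ⟩
      s + sum {n} (λ _ → 1#)               ≈⟨ +-congˡ (sum-replicate n) ⟩
      s + n × 1#                           ∎

module Characteristic {c ℓ : Level} (R : CommutativeRing c ℓ) (isField : IsField R) {n : ℕ} (card : HasCardinality R n)
                      {p k : ℕ} (pp : Prime p) (n≡p^k : n ≡ p ℕ.^ k) where
  open CommutativeRing R
  open RingProperties R using (_^_)
  open FieldProperties R isField using (1≉0; ^-≉0)
  open FiniteRing R card using (n×1≈0; _≟_)
  open import Algebra.Properties.Semiring.Mult semiring using (_×_; ×-homo-+; ×1-homo-*; ×-congˡ)
  open import Data.Nat.Divisibility using (_∤_)
  open import Data.Nat.Coprimality using (coprime-Bézout)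
  open import Data.Nat.GCD using (module Bézout)
  open Arithmetic using (prime∧∤⇒coprime)
  open import Relation.Binary.Reasoning.Setoid setoid

  p×1≈0 : p × 1# ≈ 0#
  p×1≈0 with (p × 1#) ≟ 0#
  ... | yes p×1≈0 = p×1≈0
  ... | no  p×1≉0 = ⊥-elim (^-≉0 k p×1≉0 (begin
    (p × 1#) ^ k     ≈⟨ ×1-homo-^ k ⟨
    (p ℕ.^ k) × 1#   ≈⟨ ×-congˡ (≡.sym n≡p^k) ⟩
    n × 1#           ≈⟨ n×1≈0 ⟩
    0#               ∎))
    where
    ×1-homo-^ : ∀ k → (p ℕ.^ k) × 1# ≈ (p × 1#) ^ k
    ×1-homo-^ zero    = +-identityʳ 1#
    ×1-homo-^ (suc k) = trans (×1-homo-* p (p ℕ.^ k)) (*-congˡ (×1-homo-^ k))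

  private
    bézout⇒1≈0 : ∀ x a y b → 1 ℕ.+ x ℕ.* a ≡ y ℕ.* b → a × 1# ≈ 0# → b × 1# ≈ 0# → 1# ≈ 0#
    bézout⇒1≈0 x a y b eq a×1≈0 b×1≈0 = begin
      1#                                ≈⟨ +-identityʳ 1# ⟨
      1# + 0#                           ≈⟨ +-cong (+-identityʳ 1#) (trans (*-congˡ a×1≈0) (zeroʳ _)) ⟨
      1 × 1# + (x × 1#) * (a × 1#)      ≈⟨ +-congˡ (×1-homo-* x a) ⟨
      1 × 1# + (x ℕ.* a) × 1#           ≈⟨ ×-homo-+ 1# 1 (x ℕ.* a) ⟨
      (1 ℕ.+ x ℕ.* a) × 1#              ≈⟨ ×-congˡ eq ⟩
      (y ℕ.* b) × 1#                    ≈⟨ ×1-homo-* y b ⟩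
      (y × 1#) * (b × 1#)               ≈⟨ *-congˡ b×1≈0 ⟩
      (y × 1#) * 0#                     ≈⟨ zeroʳ _ ⟩
      0#                                ∎

  p∤m⇒m×1≉0 : ∀ {m} → p ∤ m → m × 1# ≉ 0#
  p∤m⇒m×1≉0 {m} p∤m m×1≈0 with coprime-Bézout (prime∧∤⇒coprime pp p∤m)
  ... | Bézout.+- x y eq = 1≉0 (bézout⇒1≈0 y m x p eq m×1≈0 p×1≈0)
  ... | Bézout.-+ x y eq = 1≉0 (bézout⇒1≈0 x p y m eq p×1≈0 m×1≈0)

module ProjectiveGeometry {c ℓ : Level} (K : CommutativeRing c ℓ) (isField : IsField K)
                          (_≟_ : ∀ x y → Dec (CommutativeRing._≈_ K x y)) (r : ℕ) where
  open CommutativeRing K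
  open FieldProperties K isField
  open IntegerCoefficients K using (solve; _:=_; _:+_; _:*_; _:-_; :-_; con)
  open RingProperties K using (x∙y⁻¹≈ε⇒x≈y)
  open PG K r
  open import Data.Integer using (+_)
  open import Data.Product using (∃; ∃₂; _,_) renaming (_×_ to _∧_)
  open import Relation.Nullary using (¬_)
  open import Relation.Binary.Reasoning.Setoid setoid

  point-≉0 : (X : Point) → ¬ (∀ i → vec X i ≈ 0#)
  point-≉0 (v , i , vᵢ≉0) v≈0 = vᵢ≉0 (v≈0 i)

  ∼-sym : ∀ {X Y} → X ∼ Y → Y ∼ X
  ∼-sym {X} {Y} (t , t≉0 , X≈tY) = inv t t≉0 , inv-≉0 t t≉0 , λ i → sym (begin
    inv t t≉0 * vec X i        ≈⟨ *-congˡ (X≈tY i) ⟩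
    inv t t≉0 * (t * vec Y i)  ≈⟨ *-assoc _ _ _ ⟨
    (inv t t≉0 * t) * vec Y i  ≈⟨ *-congʳ (inverseˡ t t≉0) ⟩
    1# * vec Y i               ≈⟨ *-identityˡ _ ⟩
    vec Y i                    ∎)

  multiple⇒∼ : ∀ (X Y : Point) μ → (∀ i → vec X i ≈ μ * vec Y i) → X ∼ Y
  multiple⇒∼ X Y μ X≈μY with μ ≟ 0#
  ... | yes μ≈0 = ⊥-elim (point-≉0 X (λ i → trans (X≈μY i) (trans (*-congʳ μ≈0) (zeroˡ _))))
  ... | no  μ≉0 = μ , μ≉0 , X≈μY

  private
    rescale : ∀ {x y a b s₁ t₁ s₂ t₂} μ → x ≈ s₁ * a + t₁ * b → y ≈ s₂ * a + t₂ * b →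
              s₂ * μ ≈ s₁ → t₂ * μ ≈ t₁ → x ≈ μ * y
    rescale {x} {y} {a} {b} {s₁} {t₁} {s₂} {t₂} μ x≈ y≈ s₂μ≈s₁ t₂μ≈t₁ = begin
      x                           ≈⟨ x≈ ⟩
      s₁ * a + t₁ * b             ≈⟨ +-cong (*-congʳ s₂μ≈s₁) (*-congʳ t₂μ≈t₁) ⟨
      s₂ * μ * a + t₂ * μ * b
        ≈⟨ solve 5 (λ s₂ t₂ μ a b → s₂ :* μ :* a :+ t₂ :* μ :* b := μ :* (s₂ :* a :+ t₂ :* b)) refl s₂ t₂ μ a b ⟩
      μ * (s₂ * a + t₂ * b)       ≈⟨ *-congˡ y≈ ⟨
      μ * y                       ∎

  det≈0⇒∼ : ∀ (X₁ X₂ : Point) (a b : Vect) s₁ t₁ s₂ t₂ →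
            (∀ i → vec X₁ i ≈ s₁ * a i + t₁ * b i) → (∀ i → vec X₂ i ≈ s₂ * a i + t₂ * b i) →
            s₁ * t₂ - s₂ * t₁ ≈ 0# → X₁ ∼ X₂
  det≈0⇒∼ X₁ X₂ a b s₁ t₁ s₂ t₂ X₁≈ X₂≈ det≈0 =
    let μ , s₂μ≈s₁ , t₂μ≈t₁ = ratio (s₂ ≟ 0#) in
    multiple⇒∼ X₁ X₂ μ (λ i → rescale μ (X₁≈ i) (X₂≈ i) s₂μ≈s₁ t₂μ≈t₁)
    where
    s₁t₂≈s₂t₁ : s₁ * t₂ ≈ s₂ * t₁
    s₁t₂≈s₂t₁ = x∙y⁻¹≈ε⇒x≈y _ _ det≈0
    ratio : Dec (s₂ ≈ 0#) → ∃ λ μ → s₂ * μ ≈ s₁ ∧ t₂ * μ ≈ t₁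
    ratio (no s₂≉0) = s₁ * inv s₂ s₂≉0
      , trans (solve 3 (λ s₂ s₁ i → s₂ :* (s₁ :* i) := s₁ :* (s₂ :* i)) refl s₂ s₁ _)
              (trans (*-congˡ (inverseʳ s₂ s₂≉0)) (*-identityʳ s₁))
      , (begin
          t₂ * (s₁ * inv s₂ s₂≉0)     ≈⟨ solve 3 (λ t₂ s₁ i → t₂ :* (s₁ :* i) := (s₁ :* t₂) :* i) refl t₂ s₁ _ ⟩
          (s₁ * t₂) * inv s₂ s₂≉0     ≈⟨ *-congʳ s₁t₂≈s₂t₁ ⟩
          (s₂ * t₁) * inv s₂ s₂≉0     ≈⟨ solve 3 (λ s₂ t₁ i → (s₂ :* t₁) :* i := t₁ :* (s₂ :* i)) refl s₂ t₁ _ ⟩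
          t₁ * (s₂ * inv s₂ s₂≉0)     ≈⟨ trans (*-congˡ (inverseʳ s₂ s₂≉0)) (*-identityʳ t₁) ⟩
          t₁                          ∎)
    ratio (yes s₂≈0) = t₁ * inv t₂ t₂≉0
      , trans (trans (*-congʳ s₂≈0) (zeroˡ _)) (sym s₁≈0)
      , trans (solve 3 (λ t₂ t₁ i → t₂ :* (t₁ :* i) := t₁ :* (t₂ :* i)) refl t₂ t₁ _)
              (trans (*-congˡ (inverseʳ t₂ t₂≉0)) (*-identityʳ t₁))
      where
      t₂≉0 : t₂ ≉ 0#
      t₂≉0 t₂≈0 = point-≉0 X₂ (λ i → trans (X₂≈ i)
        (trans (+-cong (*-congʳ s₂≈0) (*-congʳ t₂≈0)) (trans (+-cong (zeroˡ _) (zeroˡ _)) (+-identityʳ 0#))))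
      s₁≈0 : s₁ ≈ 0#
      s₁≈0 = x≉0∧xy≈0⇒y≈0 t₂≉0 (trans (*-comm t₂ s₁) (trans s₁t₂≈s₂t₁ (trans (*-congʳ s₂≈0) (zeroˡ t₁))))

  -- Cramer's rule in the plane spanned by a and b.
  third-point-combination :
    ∀ (P₁ P₂ P₃ : Point) (a b : Vect) α₁ β₁ α₂ β₂ α₃ β₃ →
    (∀ i → vec P₁ i ≈ α₁ * a i + β₁ * b i) → (∀ i → vec P₂ i ≈ α₂ * a i + β₂ * b i) →
    (∀ i → vec P₃ i ≈ α₃ * a i + β₃ * b i) → ¬ P₁ ∼ P₂ → ¬ P₁ ∼ P₃ → ¬ P₂ ∼ P₃ →
    ∃₂ λ λ₁ λ₂ → λ₁ ≉ 0# ∧ λ₂ ≉ 0# ∧ (∀ i → vec P₃ i ≈ λ₁ * vec P₁ i + λ₂ * vec P₂ i)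
  third-point-combination P₁ P₂ P₃ a b α₁ β₁ α₂ β₂ α₃ β₃ P₁≈ P₂≈ P₃≈ P₁≁P₂ P₁≁P₃ P₂≁P₃ =
    λ₁ , λ₂ , λ₁≉0 , λ₂≉0 , P₃≈λ₁P₁+λ₂P₂
    where
    D = α₁ * β₂ - α₂ * β₁
    D≉0 : D ≉ 0#
    D≉0 D≈0 = P₁≁P₂ (det≈0⇒∼ P₁ P₂ a b α₁ β₁ α₂ β₂ P₁≈ P₂≈ D≈0)
    D⁻¹ = inv D D≉0
    λ₁ = (α₃ * β₂ - α₂ * β₃) * D⁻¹
    λ₂ = (α₁ * β₃ - α₃ * β₁) * D⁻¹
    P₃≈λ₁P₁+λ₂P₂ : ∀ i → vec P₃ i ≈ λ₁ * vec P₁ i + λ₂ * vec P₂ i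
    P₃≈λ₁P₁+λ₂P₂ i = sym (begin
      λ₁ * vec P₁ i + λ₂ * vec P₂ i
        ≈⟨ +-cong (*-congˡ (P₁≈ i)) (*-congˡ (P₂≈ i)) ⟩
      λ₁ * (α₁ * a i + β₁ * b i) + λ₂ * (α₂ * a i + β₂ * b i)
        ≈⟨ solve 9 (λ α₁ β₁ α₂ β₂ α₃ β₃ x y d →
                     ((α₃ :* β₂ :- α₂ :* β₃) :* d) :* (α₁ :* x :+ β₁ :* y)
                       :+ ((α₁ :* β₃ :- α₃ :* β₁) :* d) :* (α₂ :* x :+ β₂ :* y)
                     := ((α₁ :* β₂ :- α₂ :* β₁) :* d) :* (α₃ :* x :+ β₃ :* y))
                   refl α₁ β₁ α₂ β₂ α₃ β₃ (a i) (b i) D⁻¹ ⟩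
      (D * D⁻¹) * (α₃ * a i + β₃ * b i)  ≈⟨ *-cong (inverseʳ D D≉0) (sym (P₃≈ i)) ⟩
      1# * vec P₃ i                      ≈⟨ *-identityˡ _ ⟩
      vec P₃ i                           ∎)
    λ₁≉0 : λ₁ ≉ 0#
    λ₁≉0 λ₁≈0 = P₂≁P₃ (∼-sym {P₃} {P₂} (multiple⇒∼ P₃ P₂ λ₂ λ i →
      trans (P₃≈λ₁P₁+λ₂P₂ i) (trans (+-congʳ (trans (*-congʳ λ₁≈0) (zeroˡ _))) (+-identityˡ _))))
    λ₂≉0 : λ₂ ≉ 0#
    λ₂≉0 λ₂≈0 = P₁≁P₃ (∼-sym {P₃} {P₁} (multiple⇒∼ P₃ P₁ λ₁ λ i →
      trans (P₃≈λ₁P₁+λ₂P₂ i) (trans (+-congˡ (trans (*-congʳ λ₂≈0) (zeroˡ _))) (+-identityʳ _))))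

  collinear-relation :
    ∀ (Q₁ Q₂ Q₃ : Point) (a b : Vect) s₁ t₁ s₂ t₂ s₃ t₃ →
    (∀ i → vec Q₁ i ≈ s₁ * a i + t₁ * b i) → (∀ i → vec Q₂ i ≈ s₂ * a i + t₂ * b i) →
    (∀ i → vec Q₃ i ≈ s₃ * a i + t₃ * b i) →
    ∀ i → (s₂ * t₃ - s₃ * t₂) * vec Q₁ i + (s₃ * t₁ - s₁ * t₃) * vec Q₂ i + (s₁ * t₂ - s₂ * t₁) * vec Q₃ i ≈ 0#
  collinear-relation Q₁ Q₂ Q₃ a b s₁ t₁ s₂ t₂ s₃ t₃ Q₁≈ Q₂≈ Q₃≈ i =
    trans (+-cong (+-cong (*-congˡ (Q₁≈ i)) (*-congˡ (Q₂≈ i))) (*-congˡ (Q₃≈ i)))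
      (solve 8 (λ s₁ t₁ s₂ t₂ s₃ t₃ x y →
          (s₂ :* t₃ :- s₃ :* t₂) :* (s₁ :* x :+ t₁ :* y) :+ (s₃ :* t₁ :- s₁ :* t₃) :* (s₂ :* x :+ t₂ :* y)
            :+ (s₁ :* t₂ :- s₂ :* t₁) :* (s₃ :* x :+ t₃ :* y)
          := con (+ 0)) refl s₁ t₁ s₂ t₂ s₃ t₃ (a i) (b i))

module FiniteExtension
  {c ℓ : Level} (K F : CommutativeRing c ℓ) (isFieldK : IsField K) (isFieldF : IsField F)
  {q r : ℕ} (cardK : HasCardinality K q) (cardF : HasCardinality F (q ℕ.^ r)) (q≥2 : 2 ℕ.≤ q)
  (ι : CommutativeRing.Carrier K → CommutativeRing.Carrier F)
  (ι-hom : RingMorphisms.IsRingHomomorphism (CommutativeRing.rawRing K) (CommutativeRing.rawRing F) ι)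
  where

  module K where
    open CommutativeRing K public
    open RingProperties K public using (_^_; x∙y⁻¹≈ε⇒x≈y)
    open FieldProperties K isFieldK public
    open FiniteRing K cardK public
    open import Algebra.Properties.Semiring.Mult semiring public using (×-congʳ; ×-assoc-*)

  open CommutativeRing F
  open RingProperties F
  open FieldProperties F isFieldF
  module F = FiniteRing F cardF
  open IntegerCoefficients F using (solve; _:=_; _:+_; _:*_; _:-_; :-_)
  open RingMorphisms.IsRingHomomorphism ι-hom
    renaming (⟦⟧-cong to ι-cong; +-homo to ι-+; *-homo to ι-*; 0#-homo to ι-0; 1#-homo to ι-1; -‿homo to ι-neg)
  open import Algebra.Properties.Semiring.Mult semiring using (_×_; ×-congʳ; ×-assoc-*)
  import Algebra.Properties.CommutativeSemiring.Binomial commutativeSemiring as Binomial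
  open import Data.Nat.Combinatorics using (_C_)
  open import Algebra.Properties.Semiring.Mult K.semiring using () renaming (_×_ to _×ᴷ_)
  open import Data.Fin as Fin using (Fin; toℕ; inject₁; fromℕ)
  import Data.Fin.Properties as Fin
  open import Data.Vec.Functional using (_∷_)
  open import Data.Product using (∃; ∃₂; _,_; proj₁; proj₂) renaming (_×_ to _∧_)
  open import Data.Sum using (_⊎_; inj₁; inj₂)
  open import Relation.Nullary using (¬_; ¬?; Dec; _×-dec_)
  open import Relation.Nullary.Decidable using (decidable-stable)
  open import Relation.Binary.Definitions using (tri<; tri≈; tri>)
  import Data.Nat.DivMod as DivMod
  open import Data.Nat.Divisibility using (_∣_; _∤_; divides; m%n≡0⇒n∣m; ∣1⇒≡1)
  open import Data.Nat.Tactic.RingSolver using (solve-∀)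
  open import Relation.Binary.Reasoning.Setoid setoid

  Q : ℕ
  Q = q ℕ.^ r

  ι-≉0 : ∀ {x} → x K.≉ K.0# → ι x ≉ 0#
  ι-≉0 {x} x≉0 ιx≈0 = 1≉0 (begin
    1#                     ≈⟨ ι-1 ⟨
    ι K.1#                 ≈⟨ ι-cong (K.inverseʳ x x≉0) ⟨
    ι (x K.* K.inv x x≉0)  ≈⟨ ι-* _ _ ⟩
    ι x * ι (K.inv x x≉0)  ≈⟨ *-congʳ ιx≈0 ⟩
    0# * ι (K.inv x x≉0)   ≈⟨ zeroˡ _ ⟩
    0#                     ∎)

  ι-injective : ∀ {x y} → ι x ≈ ι y → x K.≈ y
  ι-injective {x} {y} ιx≈ιy with (x K.- y) K.≟ K.0#
  ... | yes x-y≈0 = K.x∙y⁻¹≈ε⇒x≈y x y x-y≈0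
  ... | no  x-y≉0 =
    ⊥-elim (ι-≉0 x-y≉0 (trans (ι-+ x (K.- y)) (trans (+-cong ιx≈ιy (ι-neg y)) (-‿inverseʳ (ι y)))))

  ι-^ : ∀ x n → ι (x K.^ n) ≈ ι x ^ n
  ι-^ x zero    = ι-1
  ι-^ x (suc n) = trans (ι-* _ _) (*-congˡ (ι-^ x n))

  ι-× : ∀ n x → ι (n ×ᴷ x) ≈ n × ι x
  ι-× zero    x = ι-0
  ι-× (suc n) x = trans (ι-+ _ _) (+-congˡ (ι-× n x))

  Coeffs : ℕ → Set c
  Coeffs m = Fin m → K.Carrier

  eval : ∀ {m} → Coeffs m → Carrier → Carrier
  eval a y = sum (λ i → ι (a i) * y ^ toℕ i)

  eval-cong : ∀ {m} {a b : Coeffs m} y → a K.≋ b → eval a y ≈ eval b y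
  eval-cong y a≋b = sum-cong-≋ (λ i → *-congʳ (ι-cong (a≋b i)))

  eval-∷ : ∀ {m} a₀ (a : Coeffs m) y → eval (a₀ ∷ a) y ≈ ι a₀ + y * eval a y
  eval-∷ a₀ a y = +-cong (*-identityʳ (ι a₀)) (begin
    sum (λ i → ι (a i) * (y * y ^ toℕ i))
      ≈⟨ sum-cong-≋ (λ i → solve 3 (λ a y b → a :* (y :* b) := y :* (a :* b)) refl (ι (a i)) y (y ^ toℕ i)) ⟩
    sum (λ i → y * (ι (a i) * y ^ toℕ i))   ≈⟨ *-distribˡ-sum y (λ i → ι (a i) * y ^ toℕ i) ⟨
    y * eval a y                            ∎)

  eval-last : ∀ {m} (a : Coeffs (suc m)) y →
              eval a y ≈ eval (a ∘ inject₁) y + ι (a (fromℕ m)) * y ^ m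
  eval-last {m} a y = trans (sum-init-last (λ i → ι (a i) * y ^ toℕ i)) (+-cong
    (sum-cong-≋ (λ i → *-congˡ {ι (a (inject₁ i))} (reflexive (≡.cong (y ^_) (Fin.toℕ-inject₁ i)))))
    (*-congˡ (reflexive (≡.cong (y ^_) (Fin.toℕ-fromℕ m)))))

  eval-+ : ∀ {m} (a b : Coeffs m) y → eval (λ i → a i K.+ b i) y ≈ eval a y + eval b y
  eval-+ a b y = trans (sum-cong-≋ (λ i → trans (*-congʳ (ι-+ (a i) (b i))) (distribʳ (y ^ toℕ i) (ι (a i)) (ι (b i)))))
                       (∑-distrib-+ (λ i → ι (a i) * y ^ toℕ i) (λ i → ι (b i) * y ^ toℕ i))

  eval-scale : ∀ {m} k (a : Coeffs m) y → eval (λ i → k K.* a i) y ≈ ι k * eval a y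
  eval-scale k a y = trans (sum-cong-≋ (λ i → trans (*-congʳ (ι-* k (a i))) (*-assoc (ι k) (ι (a i)) (y ^ toℕ i))))
                           (sym (*-distribˡ-sum (ι k) (λ i → ι (a i) * y ^ toℕ i)))

  eval-zero : ∀ {m} (a : Coeffs m) y → (∀ i → a i K.≈ K.0#) → eval a y ≈ 0#
  eval-zero a y a≈0 = sum-zero _ (λ i → trans (*-congʳ (trans (ι-cong (a≈0 i)) ι-0)) (zeroˡ _))

  eval-sub : ∀ {m} (a b : Coeffs m) y → eval (λ i → a i K.- b i) y ≈ eval a y - eval b y
  eval-sub a b y = trans (eval-+ a (λ i → K.- b i) y) (+-congˡ (begin
    sum (λ i → ι (K.- b i) * y ^ toℕ i)
      ≈⟨ sum-cong-≋ (λ i → trans (*-congʳ (ι-neg (b i))) (sym (-‿distribˡ-* (ι (b i)) (y ^ toℕ i)))) ⟩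
    sum (λ i → - (ι (b i) * y ^ toℕ i))   ≈⟨ -‿distrib-sum (λ i → ι (b i) * y ^ toℕ i) ⟩
    - eval b y                            ∎))
    where open import Algebra.Properties.Ring ring using (-‿distribˡ-*)

  Independent : Carrier → ℕ → Set (c ⊔ ℓ)
  Independent y m = ∀ (a : Coeffs m) → eval a y ≈ 0# → ∀ i → a i K.≈ K.0#

  Dependent : Carrier → ℕ → Set (c ⊔ ℓ)
  Dependent y m = ∃ λ (a : Coeffs m) → eval a y ≈ 0# ∧ ∃ λ i → a i K.≉ K.0#

  independent-or-dependent : ∀ y m → Independent y m ⊎ Dependent y m
  independent-or-dependent y m with K.∃? P? resp
    where
    P? : ∀ (a : Coeffs m) → Dec (eval a y ≈ 0# ∧ ∃ λ i → a i K.≉ K.0#)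
    P? a = (eval a y F.≟ 0#) ×-dec Fin.any? (λ i → ¬? (a i K.≟ K.0#))
    resp : ∀ {a b} → a K.≋ b → eval a y ≈ 0# ∧ (∃ λ i → a i K.≉ K.0#) → eval b y ≈ 0# ∧ ∃ λ i → b i K.≉ K.0#
    resp a≋b (a[y]≈0 , i , aᵢ≉0) = trans (sym (eval-cong y a≋b)) a[y]≈0 , i , λ bᵢ≈0 → aᵢ≉0 (K.trans (a≋b i) bᵢ≈0)
  ... | yes dependent = inj₂ dependent
  ... | no ¬dependent = inj₁ λ a a[y]≈0 i →
    decidable-stable (a i K.≟ K.0#) (λ aᵢ≉0 → ¬dependent (a , a[y]≈0 , i , aᵢ≉0))

  dependent? : ∀ y m → Dec (Dependent y m)
  dependent? y m with independent-or-dependent y m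
  ... | inj₁ independent = no λ (a , a[y]≈0 , i , aᵢ≉0) → aᵢ≉0 (independent a a[y]≈0 i)
  ... | inj₂ dependent   = yes dependent

  eval-injective : ∀ {y m} → Independent y m → ∀ {a b : Coeffs m} → eval a y ≈ eval b y → a K.≋ b
  eval-injective {y} independent {a} {b} a[y]≈b[y] i = K.x∙y⁻¹≈ε⇒x≈y (a i) (b i)
    (independent (λ i → a i K.- b i) (trans (eval-sub a b y) (trans (+-congʳ a[y]≈b[y]) (-‿inverseʳ _))) i)

  independent-≤ : ∀ {y m n} → m ℕ.≤ n → Independent y n → Independent y m
  independent-≤ {n = zero}  ℕ.z≤n independent = independent
  independent-≤ {y} {m} {suc n} m≤1+n independent with m ℕ.≟ suc n
  ... | yes ≡.refl = independent
  ... | no  m≢1+n  = independent-≤ (ℕ.s≤s⁻¹ (ℕ.≤∧≢⇒< m≤1+n m≢1+n)) drop-last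
    where
    drop-last : Independent y n
    drop-last a a[y]≈0 i = independent (K.0# ∷ a) (begin
      eval (K.0# ∷ a) y    ≈⟨ eval-∷ K.0# a y ⟩
      ι K.0# + y * eval a y ≈⟨ +-cong ι-0 (trans (*-congˡ a[y]≈0) (zeroʳ y)) ⟩
      0# + 0#              ≈⟨ +-identityʳ 0# ⟩
      0#                   ∎) (Fin.suc i)

  independent⇒≤r : ∀ {y m} → Independent y m → m ℕ.≤ r
  independent⇒≤r {y} {m} independent = Arithmetic.q^m≤q^n⇒m≤n q≥2 (Fin.injective⇒≤ {f = f} f-injective)
    where
    f : Fin (q ℕ.^ m) → Fin Q
    f i = F.index (eval (K.decode {m} i) y)
    f-injective : ∀ {i j} → f i ≡ f j → i ≡ j
    f-injective eq = K.decode-injective {m} (eval-injective independent (F.index-injective eq))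

  spanning⇒r≤ : ∀ {y m} → (∀ x → ∃ λ (a : Coeffs m) → eval a y ≈ x) → r ℕ.≤ m
  spanning⇒r≤ {y} {m} spanning = Arithmetic.q^m≤q^n⇒m≤n q≥2 (Fin.injective⇒≤ {f = f} f-injective)
    where
    f : Fin Q → Fin (q ℕ.^ m)
    f i = K.encode (proj₁ (spanning (F.enum i)))
    f-injective : ∀ {i j} → f i ≡ f j → i ≡ j
    f-injective {i} {j} eq = F.enum-injective i j (begin
      F.enum i                              ≈⟨ proj₂ (spanning (F.enum i)) ⟨
      eval (proj₁ (spanning (F.enum i))) y  ≈⟨ eval-cong y (K.encode-injective {m} eq) ⟩
      eval (proj₁ (spanning (F.enum j))) y  ≈⟨ proj₂ (spanning (F.enum j)) ⟩
      F.enum j                              ∎)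

  HasDegree : Carrier → ℕ → Set (c ⊔ ℓ)
  HasDegree y m = Independent y m ∧ Dependent y (suc m)

  degree : ∀ y → ∃ (HasDegree y)
  degree y = least-dependent (Arithmetic.∃-least (λ m → dependent? y (suc m)) dependent-at-r)
    where
    dependent-at-r : Dependent y (suc r)
    dependent-at-r with independent-or-dependent y (suc r)
    ... | inj₁ independent = ⊥-elim (ℕ.1+n≰n (independent⇒≤r independent))
    ... | inj₂ dependent   = dependent

    independent : ∀ m → (∀ {k} → k ℕ.< m → ¬ Dependent y (suc k)) → Independent y m
    independent zero     _     _ _ ()
    independent (suc m′) below with independent-or-dependent y (suc m′)
    ... | inj₁ independent = independent
    ... | inj₂ dependent   = ⊥-elim (below (ℕ.n<1+n m′) dependent)

    least-dependent : (∃ λ m → Dependent y (suc m) ∧ (∀ {k} → k ℕ.< m → ¬ Dependent y (suc k))) → ∃ (HasDegree y)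
    least-dependent (m , dependent , below) = m , independent m below , dependent

  degree≥1 : ∀ {y m} → HasDegree y m → 1 ℕ.≤ m
  degree≥1 {m = suc _} _                                 = ℕ.s≤s ℕ.z≤n
  degree≥1 {y} {zero} (_ , a , a[y]≈0 , Fin.zero , a₀≉0) = ⊥-elim (a₀≉0 (ι-injective (begin
    ι (a Fin.zero)          ≈⟨ *-identityʳ _ ⟨
    ι (a Fin.zero) * 1#     ≈⟨ +-identityʳ _ ⟨
    eval a y                ≈⟨ a[y]≈0 ⟩
    0#                      ≈⟨ ι-0 ⟨
    ι K.0#                  ∎)))

  eval-one : ∀ {m} y → 1 ℕ.≤ m → ∃ λ (a : Coeffs m) → eval a y ≈ 1#
  eval-one {suc m} y _ = (K.1# ∷ zeros) , (begin
    eval (K.1# ∷ zeros) y                     ≈⟨ eval-∷ K.1# zeros y ⟩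
    ι K.1# + y * eval zeros y                 ≈⟨ +-cong ι-1 (trans (*-congˡ (eval-zero zeros y (λ _ → K.refl))) (zeroʳ y)) ⟩
    1# + 0#                                   ≈⟨ +-identityʳ 1# ⟩
    1#                                        ∎)
    where
    zeros : Coeffs m
    zeros _ = K.0#

  leading≈0⇒≈0 : ∀ {y m} → Independent y m → ∀ (a : Coeffs (suc m)) → eval a y ≈ 0# →
                 a (fromℕ m) K.≈ K.0# → ∀ i → a i K.≈ K.0#
  leading≈0⇒≈0 {y} {m} independent a a[y]≈0 lead≈0 i with m ℕ.≟ toℕ i
  ... | yes m≡i =
    K.trans (K.reflexive (≡.cong a (Fin.toℕ-injective (≡.trans (≡.sym m≡i) (≡.sym (Fin.toℕ-fromℕ m)))))) lead≈0
  ... | no  m≢i = K.trans (K.reflexive (≡.cong a (≡.sym (Fin.inject₁-lower₁ i m≢i))))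
                          (independent (a ∘ inject₁) init≈0 (Fin.lower₁ i m≢i))
    where
    init≈0 : eval (a ∘ inject₁) y ≈ 0#
    init≈0 = begin
      eval (a ∘ inject₁) y                              ≈⟨ +-identityʳ _ ⟨
      eval (a ∘ inject₁) y + 0#                         ≈⟨ +-congˡ (trans (*-congʳ (trans (ι-cong lead≈0) ι-0)) (zeroˡ _)) ⟨
      eval (a ∘ inject₁) y + ι (a (fromℕ m)) * y ^ m    ≈⟨ eval-last a y ⟨
      eval a y                                          ≈⟨ a[y]≈0 ⟩
      0#                                                ∎

  module Span {y m} (deg : HasDegree y m) where

    InSpan : Carrier → Set (c ⊔ ℓ)
    InSpan x = ∃ λ (a : Coeffs m) → eval a y ≈ x

    inSpan? : ∀ x → Dec (InSpan x)
    inSpan? x = K.∃? (λ a → eval a y F.≟ x) (λ a≋b a[y]≈x → trans (sym (eval-cong y a≋b)) a[y]≈x)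

    ∈-resp : ∀ {x x′} → x ≈ x′ → InSpan x → InSpan x′
    ∈-resp x≈x′ (a , a[y]≈x) = a , trans a[y]≈x x≈x′

    0-∈ : InSpan 0#
    0-∈ = (λ _ → K.0#) , eval-zero {m} _ y (λ _ → K.refl)

    +-∈ : ∀ {x x′} → InSpan x → InSpan x′ → InSpan (x + x′)
    +-∈ (a , a[y]≈x) (b , b[y]≈x′) = (λ i → a i K.+ b i) , trans (eval-+ a b y) (+-cong a[y]≈x b[y]≈x′)

    ι*-∈ : ∀ k {x} → InSpan x → InSpan (ι k * x)
    ι*-∈ k (a , a[y]≈x) = (λ i → k K.* a i) , trans (eval-scale k a y) (*-congˡ a[y]≈x)

    -- The dependency of 1, …, y^m has a nonzero leading coefficient, which can be divided out.
    y^m-∈ : InSpan (y ^ m)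
    y^m-∈ = ∈-resp lead⁻¹*rest≈y^m (ι*-∈ (K.- lead⁻¹) (a ∘ inject₁ , refl))
      where
      a = proj₁ (proj₂ deg)
      a[y]≈0 = proj₁ (proj₂ (proj₂ deg))
      lead = a (fromℕ m)
      lead≉0 : lead K.≉ K.0#
      lead≉0 lead≈0 with proj₂ (proj₂ (proj₂ deg))
      ... | i , aᵢ≉0 = aᵢ≉0 (leading≈0⇒≈0 (proj₁ deg) a a[y]≈0 lead≈0 i)
      lead⁻¹ = K.inv lead lead≉0
      rest = eval (a ∘ inject₁) y
      rest+lead*y^m≈0 : rest + ι lead * y ^ m ≈ 0#
      rest+lead*y^m≈0 = trans (sym (eval-last a y)) a[y]≈0
      lead⁻¹*lead≈1 : ι lead⁻¹ * ι lead ≈ 1#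
      lead⁻¹*lead≈1 = trans (sym (ι-* _ _)) (trans (ι-cong (K.inverseˡ lead lead≉0)) ι-1)
      lead⁻¹*rest≈y^m : ι (K.- lead⁻¹) * rest ≈ y ^ m
      lead⁻¹*rest≈y^m = begin
        ι (K.- lead⁻¹) * rest
          ≈⟨ *-congʳ (ι-neg lead⁻¹) ⟩
        - ι lead⁻¹ * rest
          ≈⟨ solve 4 (λ i a l y → :- i :* a := (i :* l) :* y :- i :* (a :+ l :* y)) refl (ι lead⁻¹) rest (ι lead) (y ^ m) ⟩
        (ι lead⁻¹ * ι lead) * y ^ m - ι lead⁻¹ * (rest + ι lead * y ^ m)
          ≈⟨ +-cong (*-congʳ lead⁻¹*lead≈1) (-‿cong (trans (*-congˡ rest+lead*y^m≈0) (zeroʳ _))) ⟩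
        1# * y ^ m - 0#
          ≈⟨ trans (+-cong (*-identityˡ (y ^ m)) -0#≈0#) (+-identityʳ (y ^ m)) ⟩
        y ^ m ∎

    y*-∈ : ∀ {x} → InSpan x → InSpan (y * x)
    y*-∈ {x} (a , a[y]≈x) = ∈-resp shifted≈y*x (+-∈ (b ∘ inject₁ , refl) (ι*-∈ (b (fromℕ m)) y^m-∈))
      where
      b = K.0# ∷ a
      shifted≈y*x : eval (b ∘ inject₁) y + ι (b (fromℕ m)) * y ^ m ≈ y * x
      shifted≈y*x = begin
        eval (b ∘ inject₁) y + ι (b (fromℕ m)) * y ^ m ≈⟨ eval-last b y ⟨
        eval b y                                       ≈⟨ eval-∷ K.0# a y ⟩
        ι K.0# + y * eval a y                          ≈⟨ +-cong ι-0 (*-congˡ a[y]≈x) ⟩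
        0# + y * x                                     ≈⟨ +-identityˡ _ ⟩
        y * x                                          ∎

    eval*-∈ : ∀ {k} (b : Coeffs k) {x} → InSpan x → InSpan (eval b y * x)
    eval*-∈ {zero}  b {x} _   = ∈-resp (sym (zeroˡ x)) 0-∈
    eval*-∈ {suc k} b {x} x∈ =
      ∈-resp (sym b[y]*x≈) (+-∈ (ι*-∈ (b Fin.zero) x∈) (y*-∈ (eval*-∈ (b ∘ Fin.suc) x∈)))
      where
      b[y]*x≈ : eval b y * x ≈ ι (b Fin.zero) * x + y * (eval (b ∘ Fin.suc) y * x)
      b[y]*x≈ = trans (*-congʳ (eval-∷ (b Fin.zero) (b ∘ Fin.suc) y))
        (solve 4 (λ a y b x → (a :+ y :* b) :* x := a :* x :+ y :* (b :* x)) refl _ y _ x)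

    *-∈ : ∀ {x x′} → InSpan x → InSpan x′ → InSpan (x * x′)
    *-∈ (a , a[y]≈x) x′∈ = ∈-resp (*-congʳ a[y]≈x) (eval*-∈ a x′∈)

    1-∈ : InSpan 1#
    1-∈ = eval-one y (degree≥1 deg)

    ^-∈ : ∀ {x} k → InSpan x → InSpan (x ^ k)
    ^-∈ zero    _  = 1-∈
    ^-∈ (suc k) x∈ = *-∈ x∈ (^-∈ k x∈)

    y^-∈ : ∀ k → InSpan (y ^ k)
    y^-∈ zero    = 1-∈
    y^-∈ (suc k) = y*-∈ (y^-∈ k)

    span-size : ∀ {s} (φ : Fin s → Carrier) → (∀ {i j} → φ i ≈ φ j → i ≡ j) →
                (∀ j → InSpan (φ j)) → (∀ x → InSpan x → ∃ λ j → x ≈ φ j) → q ℕ.^ m ≡ s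
    span-size {s} φ φ-injective φ-∈ onto =
      ℕ.≤-antisym (Fin.injective⇒≤ {f = to} to-injective) (Fin.injective⇒≤ {f = from} from-injective)
      where
      to : Fin (q ℕ.^ m) → Fin s
      to i = proj₁ (onto (eval (K.decode {m} i) y) (K.decode i , refl))
      to-injective : ∀ {i j} → to i ≡ to j → i ≡ j
      to-injective {i} {j} eq = K.decode-injective {m} (eval-injective (proj₁ deg) (begin
        eval (K.decode {m} i) y   ≈⟨ proj₂ (onto _ (K.decode {m} i , refl)) ⟩
        φ (to i)                  ≡⟨ ≡.cong φ eq ⟩
        φ (to j)                  ≈⟨ proj₂ (onto _ (K.decode {m} j , refl)) ⟨
        eval (K.decode {m} j) y   ∎))
      from : Fin s → Fin (q ℕ.^ m)
      from j = K.encode (proj₁ (φ-∈ j))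
      from-injective : ∀ {i j} → from i ≡ from j → i ≡ j
      from-injective {i} {j} eq = φ-injective (begin
        φ i                       ≈⟨ proj₂ (φ-∈ i) ⟨
        eval (proj₁ (φ-∈ i)) y    ≈⟨ eval-cong y (K.encode-injective {m} eq) ⟩
        eval (proj₁ (φ-∈ j)) y    ≈⟨ proj₂ (φ-∈ j) ⟩
        φ j                       ∎)

  degree-1⇒∈K : ∀ {u} → HasDegree u 1 → ∃ λ a → u ≈ ι a
  degree-1⇒∈K {u} deg = constant (Span.y^m-∈ deg)
    where
    constant : ∃ (λ (a : Coeffs 1) → eval a u ≈ u ^ 1) → ∃ λ a → u ≈ ι a
    constant (a , a[u]≈u¹) = a Fin.zero , (begin
      u                        ≈⟨ *-identityʳ u ⟨
      u ^ 1                    ≈⟨ a[u]≈u¹ ⟨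
      ι (a Fin.zero) * 1# + 0# ≈⟨ +-identityʳ _ ⟩
      ι (a Fin.zero) * 1#      ≈⟨ *-identityʳ _ ⟩
      ι (a Fin.zero)           ∎)

  monomial : ∀ {n} → Fin n → K.Carrier → Coeffs n
  monomial i x j with j Fin.≟ i
  ... | yes _ = x
  ... | no  _ = K.0#

  monomial-≢ : ∀ {n} {i j : Fin n} x → j ≢ i → monomial i x j K.≈ K.0#
  monomial-≢ {i = i} {j} x j≢i with j Fin.≟ i
  ... | yes j≡i = ⊥-elim (j≢i j≡i)
  ... | no  _   = K.refl

  eval-monomial : ∀ {n} (i : Fin (suc n)) x y → eval (monomial i x) y ≈ ι x * y ^ toℕ i
  eval-monomial i x y = trans
    (sum-δ (λ j → ι (monomial i x j) * y ^ toℕ j) i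
      (λ j j≢i → trans (*-congʳ (trans (ι-cong (monomial-≢ x j≢i)) ι-0)) (zeroˡ _)))
    (*-congʳ (ι-cong monomial-≡))
    where
    monomial-≡ : monomial i x i K.≈ x
    monomial-≡ with i Fin.≟ i
    ... | yes _   = K.refl
    ... | no  i≢i = ⊥-elim (i≢i ≡.refl)

  binomial-coeffs : ∀ n → K.Carrier → K.Carrier → Coeffs (suc n)
  binomial-coeffs n a b j = (n C toℕ j) ×ᴷ (b K.^ toℕ j K.* a K.^ (n ℕ.∸ toℕ j))

  eval-binomial : ∀ n a b y → eval (binomial-coeffs n a b) y ≈ (ι a + ι b * y) ^ n
  eval-binomial n a b y = begin
    eval (binomial-coeffs n a b) y              ≈⟨ sum-cong-≋ term≈ ⟩
    Binomial.binomialExpansion (ι b * y) (ι a) n ≈⟨ Binomial.theorem n (ι b * y) (ι a) ⟨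
    (ι b * y + ι a) ^ n                          ≈⟨ ^-congˡ n (+-comm _ _) ⟩
    (ι a + ι b * y) ^ n                          ∎
    where
    term≈ : ∀ j → ι (binomial-coeffs n a b j) * y ^ toℕ j ≈ Binomial.binomialTerm (ι b * y) (ι a) n j
    term≈ j = begin
      ι ((n C k) ×ᴷ (b K.^ k K.* a K.^ (n ℕ.∸ k))) * y ^ k
        ≈⟨ *-congʳ (trans (ι-× (n C k) _) (×-congʳ (n C k) (trans (ι-* _ _) (*-cong (ι-^ b k) (ι-^ a (n ℕ.∸ k)))))) ⟩
      ((n C k) × (ι b ^ k * ι a ^ (n ℕ.∸ k))) * y ^ k
        ≈⟨ ×-assoc-* (n C k) _ _ ⟩
      (n C k) × ((ι b ^ k * ι a ^ (n ℕ.∸ k)) * y ^ k)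
        ≈⟨ ×-congʳ (n C k) (solve 3 (λ x y z → (x :* y) :* z := (x :* z) :* y) refl _ _ _) ⟩
      (n C k) × ((ι b ^ k * y ^ k) * ι a ^ (n ℕ.∸ k))
        ≈⟨ ×-congʳ (n C k) (*-congʳ (^-distrib-* (ι b) y k)) ⟨
      (n C k) × ((ι b * y) ^ k * ι a ^ (n ℕ.∸ k))  ∎
      where k = toℕ j

  module Primitive (z : Carrier) (z-primitive : IsPrimitive F z) (z≉0 : z ≉ 0#) where

    log : ∀ x → x ≉ 0# → ∃ λ k → x ≈ z ^ k
    log x x≉0 with z-primitive x x≉0
    ... | k , x≈z^k = k , trans x≈z^k (reflexive (pow≡^ z k))

    private
      z^-cancel : ∀ a d → z ^ a ≈ z ^ (a ℕ.+ d) → z ^ d ≈ 1#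
      z^-cancel a d z^a≈z^[a+d] = sym (*-cancelˡ (^-≉0 a z≉0)
        (trans (*-identityʳ _) (trans z^a≈z^[a+d] (^-homo-* z a d))))

      IsPeriod : ℕ → Set ℓ
      IsPeriod o = 0 ℕ.< o ∧ z ^ o ≈ 1#

      isPeriod? : ∀ o → Dec (IsPeriod o)
      isPeriod? o = (0 ℕ.<? o) ×-dec (z ^ o F.≟ 1#)

      period : ∃ IsPeriod
      period with Fin.pigeonhole (ℕ.n<1+n Q) (λ (i : Fin (suc Q)) → F.index (z ^ toℕ i))
      ... | i , j , i<j , eq = toℕ j ℕ.∸ toℕ i , ℕ.m<n⇒0<n∸m i<j ,
        z^-cancel (toℕ i) _ (trans (F.index-injective eq) (^-congʳ z (≡.sym (ℕ.m+[n∸m]≡n (ℕ.<⇒≤ i<j)))))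

      leastPeriod : ∃ λ N → IsPeriod N ∧ (∀ {o} → o ℕ.< N → ¬ IsPeriod o)
      leastPeriod = Arithmetic.∃-least isPeriod? (proj₂ period)

    opaque
      N : ℕ
      N = proj₁ leastPeriod

      N>0 : 0 ℕ.< N
      N>0 = proj₁ (proj₁ (proj₂ leastPeriod))

      z^N≈1 : z ^ N ≈ 1#
      z^N≈1 = proj₂ (proj₁ (proj₂ leastPeriod))

      N-minimal : ∀ {o} → 0 ℕ.< o → o ℕ.< N → z ^ o ≉ 1#
      N-minimal o>0 o<N z^o≈1 = proj₂ (proj₂ leastPeriod) o<N (o>0 , z^o≈1)

    instance
      N≢0 : ℕ.NonZero N
      N≢0 = ℕ.>-nonZero N>0

    private
      no-smaller-period : ∀ {i j} → i ℕ.< j → j ℕ.< N → z ^ i ≉ z ^ j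
      no-smaller-period {i} {j} i<j j<N z^i≈z^j = N-minimal (ℕ.m<n⇒0<n∸m i<j) (ℕ.≤-<-trans (ℕ.m∸n≤m j i) j<N)
        (z^-cancel i _ (trans z^i≈z^j (^-congʳ z (≡.sym (ℕ.m+[n∸m]≡n (ℕ.<⇒≤ i<j))))))

    z^-injective : ∀ {i j} → i ℕ.< N → j ℕ.< N → z ^ i ≈ z ^ j → i ≡ j
    z^-injective {i} {j} i<N j<N z^i≈z^j with ℕ.<-cmp i j
    ... | tri< i<j _ _ = ⊥-elim (no-smaller-period i<j j<N z^i≈z^j)
    ... | tri≈ _ i≡j _ = i≡j
    ... | tri> _ _ j<i = ⊥-elim (no-smaller-period j<i i<N (sym z^i≈z^j))

    z^-mod : ∀ k → z ^ k ≈ z ^ (k ℕ.% N)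
    z^-mod k = trans (^-congʳ z (DivMod.m≡m%n+[m/n]*n k N)) (^-periodic z^N≈1 (k ℕ.% N) (k ℕ./ N))

    log< : ∀ x → x ≉ 0# → ∃ λ k → k ℕ.< N ∧ x ≈ z ^ k
    log< x x≉0 with log x x≉0
    ... | k , x≈z^k = k ℕ.% N , DivMod.m%n<n k N , trans x≈z^k (z^-mod k)

    x^N≈1 : ∀ {x} → x ≉ 0# → x ^ N ≈ 1#
    x^N≈1 {x} x≉0 with log x x≉0
    ... | k , x≈z^k = begin
      x ^ N              ≈⟨ ^-congˡ N x≈z^k ⟩
      (z ^ k) ^ N        ≈⟨ ^-assocʳ z k N ⟩
      z ^ (k ℕ.* N)      ≈⟨ ^-periodic z^N≈1 0 k ⟩
      1#                 ∎

    -- The nonzero elements of the span form the subgroup of ⟨z⟩ generated by z^t, t least with z^t in the span.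
    module SubfieldOrder {y m} (deg : HasDegree y m) where
      open Span deg

      private
        IsStep : ℕ → Set (c ⊔ ℓ)
        IsStep t = 0 ℕ.< t ∧ InSpan (z ^ t)

        leastStep : ∃ λ t → IsStep t ∧ (∀ {k} → k ℕ.< t → ¬ IsStep k)
        leastStep = Arithmetic.∃-least (λ t → (0 ℕ.<? t) ×-dec inSpan? (z ^ t)) {N} (N>0 , ∈-resp (sym z^N≈1) 1-∈)

      opaque
        t : ℕ
        t = proj₁ leastStep

        t>0 : 0 ℕ.< t
        t>0 = proj₁ (proj₁ (proj₂ leastStep))

        z^t-∈ : InSpan (z ^ t)
        z^t-∈ = proj₂ (proj₁ (proj₂ leastStep))

        t-minimal : ∀ {k} → 0 ℕ.< k → k ℕ.< t → ¬ InSpan (z ^ k)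
        t-minimal k>0 k<t z^k-∈ = proj₂ (proj₂ leastStep) k<t (k>0 , z^k-∈)

      instance
        t≢0 : ℕ.NonZero t
        t≢0 = ℕ.>-nonZero t>0

      -- Dividing i by t, the power z^(i mod t) = z^i · (z^t)^((i / t)(N - 1)) lies in the span.
      t∣ : ∀ i → InSpan (z ^ i) → t ∣ i
      t∣ i z^i-∈ with i ℕ.% t ℕ.≟ 0
      ... | yes ρ≡0 = m%n≡0⇒n∣m i t ρ≡0
      ... | no  ρ≢0 = ⊥-elim (t-minimal (ℕ.n≢0⇒n>0 ρ≢0) (DivMod.m%n<n i t) z^ρ-∈)
        where
        ρ = i ℕ.% t
        s = i ℕ./ t
        exponent : i ℕ.+ t ℕ.* (s ℕ.* ℕ.pred N) ≡ ρ ℕ.+ (s ℕ.* t) ℕ.* N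
        exponent = ≡.trans (≡.cong (ℕ._+ t ℕ.* (s ℕ.* ℕ.pred N)) (DivMod.m≡m%n+[m/n]*n i t))
                  (≡.trans (regroup ρ s t (ℕ.pred N)) (≡.cong (λ n → ρ ℕ.+ (s ℕ.* t) ℕ.* n) (ℕ.suc-pred N)))
          where
          regroup : ∀ ρ s t n → ρ ℕ.+ s ℕ.* t ℕ.+ t ℕ.* (s ℕ.* n) ≡ ρ ℕ.+ (s ℕ.* t) ℕ.* suc n
          regroup = solve-∀
        z^ρ-∈ : InSpan (z ^ ρ)
        z^ρ-∈ = ∈-resp (begin
          z ^ i * (z ^ t) ^ (s ℕ.* ℕ.pred N)   ≈⟨ *-congˡ (^-assocʳ z t _) ⟩
          z ^ i * z ^ (t ℕ.* (s ℕ.* ℕ.pred N)) ≈⟨ ^-homo-* z i _ ⟨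
          z ^ (i ℕ.+ t ℕ.* (s ℕ.* ℕ.pred N))   ≈⟨ ^-congʳ z exponent ⟩
          z ^ (ρ ℕ.+ (s ℕ.* t) ℕ.* N)          ≈⟨ ^-periodic z^N≈1 ρ (s ℕ.* t) ⟩
          z ^ ρ                                ∎)
          (*-∈ z^i-∈ (^-∈ (s ℕ.* ℕ.pred N) z^t-∈))

      private
        t∣N : t ∣ N
        t∣N = t∣ N (∈-resp (sym z^N≈1) 1-∈)

        M : ℕ
        M = _∣_.quotient t∣N

        N≡M*t : N ≡ M ℕ.* t
        N≡M*t = _∣_.equality t∣N

        t*j<N : ∀ {j} → j ℕ.< M → t ℕ.* j ℕ.< N
        t*j<N {j} j<M = ≡.subst (t ℕ.* j ℕ.<_) (≡.trans (ℕ.*-comm t M) (≡.sym N≡M*t)) (ℕ.*-monoʳ-< t j<M)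

        φ : Fin (suc M) → Carrier
        φ Fin.zero    = 0#
        φ (Fin.suc j) = z ^ (t ℕ.* toℕ j)

        φ-injective : ∀ {i j} → φ i ≈ φ j → i ≡ j
        φ-injective {Fin.zero}  {Fin.zero}  _  = ≡.refl
        φ-injective {Fin.zero}  {Fin.suc j} eq = ⊥-elim (^-≉0 (t ℕ.* toℕ j) z≉0 (sym eq))
        φ-injective {Fin.suc i} {Fin.zero}  eq = ⊥-elim (^-≉0 (t ℕ.* toℕ i) z≉0 eq)
        φ-injective {Fin.suc i} {Fin.suc j} eq = ≡.cong Fin.suc (Fin.toℕ-injective
          (ℕ.*-cancelˡ-≡ (toℕ i) (toℕ j) t (z^-injective (t*j<N (Fin.toℕ<n i)) (t*j<N (Fin.toℕ<n j)) eq)))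

        φ-∈ : ∀ j → InSpan (φ j)
        φ-∈ Fin.zero    = 0-∈
        φ-∈ (Fin.suc j) = ∈-resp (^-assocʳ z t (toℕ j)) (^-∈ (toℕ j) z^t-∈)

        φ-onto : ∀ x → InSpan x → ∃ λ j → x ≈ φ j
        φ-onto x x-∈ with x F.≟ 0#
        ... | yes x≈0 = Fin.zero , x≈0
        ... | no  x≉0 with log< x x≉0
        ...   | k , k<N , x≈z^k with t∣ k (∈-resp x≈z^k x-∈)
        ...     | divides j k≡j*t = Fin.suc (Fin.fromℕ< j<M) , trans x≈z^k (^-congʳ z k≡t*j)
          where
          j<M : j ℕ.< M
          j<M = ℕ.*-cancelʳ-< t j M (≡.subst₂ ℕ._<_ k≡j*t N≡M*t k<N)
          k≡t*j : k ≡ t ℕ.* toℕ (Fin.fromℕ< j<M)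
          k≡t*j = ≡.trans k≡j*t (≡.trans (ℕ.*-comm j t) (≡.cong (t ℕ.*_) (≡.sym (Fin.toℕ-fromℕ< j<M))))

      [q^m∸1]*t≡N : (q ℕ.^ m ℕ.∸ 1) ℕ.* t ≡ N
      [q^m∸1]*t≡N =
        ≡.trans (≡.cong (λ n → (n ℕ.∸ 1) ℕ.* t) (span-size φ φ-injective φ-∈ φ-onto)) (≡.sym N≡M*t)

    spans : ∀ {m} (deg : HasDegree z m) x → Span.InSpan deg x
    spans deg x with x F.≟ 0#
    ... | yes x≈0 = Span.∈-resp deg (sym x≈0) (Span.0-∈ deg)
    ... | no  x≉0 = Span.∈-resp deg (sym (proj₂ (log x x≉0))) (Span.y^-∈ deg (proj₁ (log x x≉0)))

    z-has-degree-r : HasDegree z r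
    z-has-degree-r = degree-r (degree z)
      where
      degree-r : ∃ (HasDegree z) → HasDegree z r
      degree-r (m , deg) =
        ≡.subst (HasDegree z) (ℕ.≤-antisym (independent⇒≤r (proj₁ deg)) (spanning⇒r≤ (spans deg))) deg

    N≡Q∸1 : N ≡ Q ℕ.∸ 1
    N≡Q∸1 = ≡.trans (≡.sym [q^m∸1]*t≡N) (≡.trans (≡.cong ((Q ℕ.∸ 1) ℕ.*_) t≡1) (ℕ.*-identityʳ _))
      where
      open SubfieldOrder z-has-degree-r
      t≡1 : t ≡ 1
      t≡1 = ∣1⇒≡1 (t∣ 1 (Span.y^-∈ z-has-degree-r 1))

    degree∣r : ∀ {y m} → HasDegree y m → m ∣ r
    degree∣r {y} {m} deg = Arithmetic.[q^m∸1]∣[q^n∸1]⇒m∣n r q≥2 (degree≥1 deg)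
      (divides t (≡.trans (≡.sym N≡Q∸1) (≡.trans (≡.sym [q^m∸1]*t≡N) (ℕ.*-comm _ t))))
      where open SubfieldOrder deg

    module _ {w : ℕ} (r⊥w! : Coprime r (w ℕ.!)) where

      -- The degree of u divides r and is prime to w!, so it is 1 (u ∈ K) or exceeds w.
      ∉K⇒independent : ∀ {u} → (∀ a → u ≉ ι a) → Independent u (suc w)
      ∉K⇒independent {u} u∉K = from-degree (degree u)
        where
        from-degree : ∃ (HasDegree u) → Independent u (suc w)
        from-degree (m , deg) with suc w ℕ.≤? m
        ... | yes 1+w≤m = independent-≤ 1+w≤m (proj₁ deg)
        ... | no  1+w≰m = ⊥-elim (m≢1 (r⊥w! (degree∣r deg , Arithmetic.m∣n! (degree≥1 deg) (ℕ.≮⇒≥ 1+w≰m))))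
          where
          m≢1 : m ≢ 1
          m≢1 ≡.refl = let a , u≈ιa = degree-1⇒∈K deg in u∉K a u≈ιa

      module _ {p e : ℕ} (pp : Prime p) (q≡p^e : q ≡ p ℕ.^ e) (w≥2 : 2 ℕ.≤ w)
               (w≢p^s : ¬ ∃ λ s → w ≡ p ℕ.^ s) where

        private
          relation-coeffs : (c₁ c₂ c₃ a b : K.Carrier) → Coeffs (suc w)
          relation-coeffs c₁ c₂ c₃ a b j =
            c₃ K.* binomial-coeffs w a b j K.+ monomial Fin.zero c₁ j K.+ monomial (fromℕ w) c₂ j

          eval-relation-coeffs : ∀ c₁ c₂ c₃ a b u → eval (relation-coeffs c₁ c₂ c₃ a b) u ≈
                                 ι c₁ + ι c₂ * u ^ w + ι c₃ * (ι a + ι b * u) ^ w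
          eval-relation-coeffs c₁ c₂ c₃ a b u = begin
            eval (relation-coeffs c₁ c₂ c₃ a b) u
              ≈⟨ eval-+ (λ j → c₃ K.* β j K.+ μ₁ j) μ₂ u ⟩
            eval (λ j → c₃ K.* β j K.+ μ₁ j) u + eval μ₂ u
              ≈⟨ +-congʳ (eval-+ (λ j → c₃ K.* β j) μ₁ u) ⟩
            eval (λ j → c₃ K.* β j) u + eval μ₁ u + eval μ₂ u
              ≈⟨ +-cong (+-cong (trans (eval-scale c₃ β u) (*-congˡ (eval-binomial w a b u)))
                                (trans (eval-monomial {w} Fin.zero c₁ u) (*-identityʳ (ι c₁))))
                        (trans (eval-monomial (fromℕ w) c₂ u) (*-congˡ (reflexive (≡.cong (u ^_) (Fin.toℕ-fromℕ w))))) ⟩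
            ι c₃ * (ι a + ι b * u) ^ w + ι c₁ + ι c₂ * u ^ w
              ≈⟨ solve 3 (λ x y z → x :+ y :+ z := y :+ z :+ x) refl _ (ι c₁) _ ⟩
            ι c₁ + ι c₂ * u ^ w + ι c₃ * (ι a + ι b * u) ^ w ∎
            where
            β μ₁ μ₂ : Coeffs (suc w)
            β = binomial-coeffs w a b
            μ₁ = monomial Fin.zero c₁
            μ₂ = monomial (fromℕ w) c₂

        -- Independence isolates the coefficient c₃ (w C k) b^k a^(w-k) of u^k, nonzero when p ∤ w C k.
        binomial-relation-≉0 : ∀ {u} → (∀ a → u ≉ ι a) → ∀ c₁ c₂ c₃ a b →
                               c₃ K.≉ K.0# → a K.≉ K.0# → b K.≉ K.0# →
                               ι c₁ + ι c₂ * u ^ w + ι c₃ * (ι a + ι b * u) ^ w ≉ 0#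
        binomial-relation-≉0 {u} u∉K c₁ c₂ c₃ a b c₃≉0 a≉0 b≉0 relation≈0 =
          coefficient≉0 (Arithmetic.∃[k]p∤wCk pp w≥2 w≢p^s)
          where
          γ = relation-coeffs c₁ c₂ c₃ a b
          γ≈0 : ∀ j → γ j K.≈ K.0#
          γ≈0 = ∉K⇒independent u∉K γ (trans (eval-relation-coeffs c₁ c₂ c₃ a b u) relation≈0)
          coefficient≉0 : ¬ ∃ λ k → 0 ℕ.< k ∧ k ℕ.< w ∧ p ∤ w C k
          coefficient≉0 (k , k>0 , k<w , p∤wCk) = K.*-≉0 c₃≉0 binomial≉0 (K.trans (K.sym γj≈c₃βj) (γ≈0 j))
            where
            j : Fin (suc w)
            j = Fin.fromℕ< (ℕ.<-trans k<w (ℕ.n<1+n w))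
            toℕ-j : toℕ j ≡ k
            toℕ-j = Fin.toℕ-fromℕ< _
            j≢0 : j ≢ Fin.zero
            j≢0 j≡0 = ℕ.<⇒≢ k>0 (≡.trans (≡.sym (≡.cong toℕ j≡0)) toℕ-j)
            j≢w : j ≢ fromℕ w
            j≢w j≡w = ℕ.<⇒≢ k<w (≡.trans (≡.sym toℕ-j) (≡.trans (≡.cong toℕ j≡w) (Fin.toℕ-fromℕ w)))
            γj≈c₃βj : γ j K.≈ c₃ K.* binomial-coeffs w a b j
            γj≈c₃βj = K.trans (K.+-cong (K.+-congˡ (monomial-≢ c₁ j≢0)) (monomial-≢ c₂ j≢w))
                              (K.trans (K.+-identityʳ _) (K.+-identityʳ _))
            binomial≉0 : binomial-coeffs w a b j K.≉ K.0#
            binomial≉0 β≈0 = K.*-≉0 wCk×1≉0 (K.*-≉0 (K.^-≉0 (toℕ j) b≉0) (K.^-≉0 (w ℕ.∸ toℕ j) a≉0))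
              (K.trans (K.×-assoc-* (w C toℕ j) K.1# _) (K.trans (K.×-congʳ (w C toℕ j) (K.*-identityˡ _)) β≈0))
              where
              wCk×1≉0 : (w C toℕ j) ×ᴷ K.1# K.≉ K.0#
              wCk×1≉0 = Characteristic.p∤m⇒m×1≉0 K isFieldK cardK {p} {e} pp q≡p^e
                          (≡.subst (λ k → p ∤ w C k) (≡.sym toℕ-j) p∤wCk)

    module Labelling where
      open PG K r
      open Labels K F ι z r

      label≈z*eval : ∀ v → label v ≈ z * eval v z
      label≈z*eval v = begin
        label v                                          ≡⟨ sumFin≡sum r _ ⟩
        sum (λ i → ι (v i) * pow F z (suc (toℕ i)))
          ≈⟨ sum-cong-≋ (λ i → *-congˡ {ι (v i)} (reflexive (pow≡^ z (suc (toℕ i))))) ⟩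
        sum (λ i → ι (v i) * (z * z ^ toℕ i))
          ≈⟨ sum-cong-≋ (λ i → solve 3 (λ a z b → a :* (z :* b) := z :* (a :* b)) refl (ι (v i)) z (z ^ toℕ i)) ⟩
        sum (λ i → z * (ι (v i) * z ^ toℕ i))            ≈⟨ *-distribˡ-sum z (λ i → ι (v i) * z ^ toℕ i) ⟨
        z * eval v z                                     ∎

      label-cong : ∀ {u v} → u K.≋ v → label u ≈ label v
      label-cong {u} {v} u≋v = trans (label≈z*eval u) (trans (*-congˡ (eval-cong z u≋v)) (sym (label≈z*eval v)))

      label-injective : ∀ {u v} → label u ≈ label v → u K.≋ v
      label-injective {u} {v} eq = eval-injective (proj₁ z-has-degree-r)
        (*-cancelˡ z≉0 (trans (sym (label≈z*eval u)) (trans eq (label≈z*eval v))))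

      label-+ : ∀ u v → label (λ i → u i K.+ v i) ≈ label u + label v
      label-+ u v = begin
        label (λ i → u i K.+ v i)           ≈⟨ label≈z*eval _ ⟩
        z * eval (λ i → u i K.+ v i) z      ≈⟨ *-congˡ (eval-+ u v z) ⟩
        z * (eval u z + eval v z)           ≈⟨ distribˡ z _ _ ⟩
        z * eval u z + z * eval v z         ≈⟨ +-cong (label≈z*eval u) (label≈z*eval v) ⟨
        label u + label v                   ∎

      label-scale : ∀ t v → label (λ i → t K.* v i) ≈ ι t * label v
      label-scale t v = begin
        label (λ i → t K.* v i)              ≈⟨ label≈z*eval _ ⟩
        z * eval (λ i → t K.* v i) z         ≈⟨ *-congˡ (eval-scale t v z) ⟩
        z * (ι t * eval v z)                 ≈⟨ solve 3 (λ z t a → z :* (t :* a) := t :* (z :* a)) refl z (ι t) _ ⟩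
        ι t * (z * eval v z)                 ≈⟨ *-congˡ (label≈z*eval v) ⟨
        ι t * label v                        ∎

      label-zero : ∀ v → (∀ i → v i K.≈ K.0#) → label v ≈ 0#
      label-zero v v≈0 = trans (label≈z*eval v) (trans (*-congˡ (eval-zero v z v≈0)) (zeroʳ z))

      label-surjective : ∀ x → ∃ λ v → label v ≈ x
      label-surjective x = v , (begin
        label v                      ≈⟨ label≈z*eval v ⟩
        z * eval v z                 ≈⟨ *-congˡ (proj₂ spanned) ⟩
        z * (x * z⁻¹)                ≈⟨ solve 3 (λ z x i → z :* (x :* i) := x :* (z :* i)) refl z x z⁻¹ ⟩
        x * (z * z⁻¹)                ≈⟨ *-congˡ (inverseʳ z z≉0) ⟩
        x * 1#                       ≈⟨ *-identityʳ x ⟩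
        x                            ∎)
        where
        z⁻¹ = inv z z≉0
        spanned = spans z-has-degree-r (x * z⁻¹)
        v = proj₁ spanned

      point-with-label : ∀ x → x ≉ 0# → ∃ λ (P : Point) → label (vec P) ≈ x
      point-with-label x x≉0 = as-point (label-surjective x)
        where
        as-point : ∃ (λ v → label v ≈ x) → ∃ λ (P : Point) → label (vec P) ≈ x
        as-point (v , v≈x) with K.zero-or-nonzero v
        ... | inj₁ v≈0  = ⊥-elim (x≉0 (trans (sym v≈x) (label-zero v v≈0)))
        ... | inj₂ vᵢ≉0 = (v , vᵢ≉0) , v≈x

      label-≉0 : (P : Point) → label (vec P) ≉ 0#
      label-≉0 (v , i , vᵢ≉0) label≈0 =
        vᵢ≉0 (label-injective {v} {λ _ → K.0#} (trans label≈0 (sym (label-zero _ (λ _ → K.refl)))) i)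

    module Root {w : ℕ} (w⊥Q-1 : Coprime w (Q ℕ.∸ 1)) where

      private
        inverse : ∃ λ e → ∃₂ λ k l → w ℕ.* e ℕ.+ k ℕ.* N ≡ 1 ℕ.+ l ℕ.* N
        inverse = Arithmetic.coprime⇒invertible-mod (≡.subst (Coprime w) (≡.sym N≡Q∸1) w⊥Q-1) N>0

      opaque
        w⁻¹ : ℕ
        w⁻¹ = proj₁ inverse

        ^[w*w⁻¹] : ∀ {x} → x ≉ 0# → x ^ (w ℕ.* w⁻¹) ≈ x
        ^[w*w⁻¹] {x} x≉0 = trans (^-cong-mod (x^N≈1 x≉0) (proj₁ (proj₂ inverse)) (proj₁ (proj₂ (proj₂ inverse)))
                                             (proj₂ (proj₂ (proj₂ inverse))))
                                 (*-identityʳ x)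

      root : Carrier → Carrier
      root x = x ^ w⁻¹

      root-^ : ∀ {x} → x ≉ 0# → root x ^ w ≈ x
      root-^ {x} x≉0 = trans (^-assocʳ x w⁻¹ w) (trans (^-congʳ x (ℕ.*-comm w⁻¹ w)) (^[w*w⁻¹] x≉0))

      ^-root : ∀ {x} → x ≉ 0# → root (x ^ w) ≈ x
      ^-root {x} x≉0 = trans (^-assocʳ x w w⁻¹) (^[w*w⁻¹] x≉0)

    module Orthomorphism {w : ℕ} (w≥2 : 2 ℕ.≤ w) (w⊥Q-1 : Coprime w (Q ℕ.∸ 1)) (r⊥w! : Coprime r (w ℕ.!))
                         {p e : ℕ} (pp : Prime p) (q≡p^e : q ≡ p ℕ.^ e) (w≢p^s : ¬ ∃ λ s → w ≡ p ℕ.^ s) where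
      open PG K r
      open Labels K F ι z r
      open Labelling
      open Root w⊥Q-1
      open ProjectiveGeometry K isFieldK K._≟_ r

      Φ : Point → Point → Set (c ⊔ ℓ)
      Φ P Q = Lift c (Φgraph w P Q)

      Φ⇒ : ∀ P Q → Φ P Q → label (vec Q) ≈ label (vec P) ^ w
      Φ⇒ P Q (lift φ) = trans φ (reflexive (pow≡^ (label (vec P)) w))

      ⇒Φ : ∀ P Q → label (vec Q) ≈ label (vec P) ^ w → Φ P Q
      ⇒Φ P Q Q≈P^w = lift (trans Q≈P^w (reflexive (≡.sym (pow≡^ (label (vec P)) w))))

      private
        label-∼ : ∀ {P P′ : Point} {t} → (∀ i → vec P i K.≈ t K.* vec P′ i) → label (vec P) ≈ ι t * label (vec P′)
        label-∼ {P′ = P′} {t} P≈tP′ = trans (label-cong P≈tP′) (label-scale t (vec P′))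


      total : ∀ P → ∃ λ Q → Φ P Q
      total P = proj₁ image , ⇒Φ P (proj₁ image) (proj₂ image)
        where image = point-with-label (label (vec P) ^ w) (^-≉0 w (label-≉0 P))

      well-defined : ∀ P P′ Q Q′ → Φ P Q → Φ P′ Q′ → P ∼ P′ → Q ∼ Q′
      well-defined P P′ Q Q′ φ φ′ (t , t≉0 , P≈tP′) =
        t K.^ w , K.^-≉0 w t≉0 , label-injective {vec Q} {λ i → t K.^ w K.* vec Q′ i} (begin
        label (vec Q)                          ≈⟨ Φ⇒ P Q φ ⟩
        label (vec P) ^ w                      ≈⟨ ^-congˡ w (label-∼ {P} {P′} P≈tP′) ⟩
        (ι t * label (vec P′)) ^ w             ≈⟨ ^-distrib-* (ι t) _ w ⟩
        ι t ^ w * label (vec P′) ^ w           ≈⟨ *-cong (ι-^ t w) (Φ⇒ P′ Q′ φ′) ⟨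
        ι (t K.^ w) * label (vec Q′)           ≈⟨ label-scale (t K.^ w) (vec Q′) ⟨
        label (λ i → t K.^ w K.* vec Q′ i)     ∎)

      injective : ∀ P P′ Q Q′ → Φ P Q → Φ P′ Q′ → Q ∼ Q′ → P ∼ P′
      injective P P′ Q Q′ φ φ′ (t , t≉0 , Q≈tQ′) =
        t K.^ w⁻¹ , K.^-≉0 w⁻¹ t≉0 , label-injective {vec P} {λ i → t K.^ w⁻¹ K.* vec P′ i} (begin
        label (vec P)                          ≈⟨ ^-root (label-≉0 P) ⟨
        root (label (vec P) ^ w)               ≈⟨ ^-congˡ w⁻¹ (Φ⇒ P Q φ) ⟨
        root (label (vec Q))                   ≈⟨ ^-congˡ w⁻¹ (label-∼ {Q} {Q′} Q≈tQ′) ⟩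
        root (ι t * label (vec Q′))            ≈⟨ ^-distrib-* (ι t) _ w⁻¹ ⟩
        ι t ^ w⁻¹ * root (label (vec Q′))      ≈⟨ *-cong (sym (ι-^ t w⁻¹)) (^-congˡ w⁻¹ (Φ⇒ P′ Q′ φ′)) ⟩
        ι (t K.^ w⁻¹) * root (label (vec P′) ^ w) ≈⟨ *-congˡ (^-root (label-≉0 P′)) ⟩
        ι (t K.^ w⁻¹) * label (vec P′)         ≈⟨ label-scale (t K.^ w⁻¹) (vec P′) ⟨
        label (λ i → t K.^ w⁻¹ K.* vec P′ i)   ∎)

      surjective : ∀ Q → ∃ λ P → Φ P Q
      surjective Q =
        proj₁ preimage , ⇒Φ (proj₁ preimage) Q (sym (trans (^-congˡ w (proj₂ preimage)) (root-^ (label-≉0 Q))))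
        where preimage = point-with-label (root (label (vec Q))) (^-≉0 w⁻¹ (label-≉0 Q))

      private
        -- Dividing by label(P₁)^w turns a relation among the w-th powers into one in u = label P₂ / label P₁ ∉ K.
        powers-unrelated : ∀ (P₁ P₂ P₃ : Point) λ₁ λ₂ → λ₁ K.≉ K.0# → λ₂ K.≉ K.0# →
                           (∀ i → vec P₃ i K.≈ λ₁ K.* vec P₁ i K.+ λ₂ K.* vec P₂ i) → ¬ P₁ ∼ P₂ →
                           ∀ c₁ c₂ c₃ → c₃ K.≉ K.0# →
                           ι c₁ * label (vec P₁) ^ w + ι c₂ * label (vec P₂) ^ w + ι c₃ * label (vec P₃) ^ w ≉ 0#
        powers-unrelated P₁ P₂ P₃ λ₁ λ₂ λ₁≉0 λ₂≉0 P₃≈ P₁≁P₂ c₁ c₂ c₃ c₃≉0 relation≈0 =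
          binomial-relation-≉0 r⊥w! {p} {e} pp q≡p^e w≥2 w≢p^s u∉K c₁ c₂ c₃ λ₁ λ₂ c₃≉0 λ₁≉0 λ₂≉0
            (x≉0∧xy≈0⇒y≈0 (^-≉0 w X₁≉0) (begin
              X₁ ^ w * (ι c₁ + ι c₂ * u ^ w + ι c₃ * (ι λ₁ + ι λ₂ * u) ^ w)
                ≈⟨ solve 6 (λ x a b c d e → x :* (a :+ b :* d :+ c :* e) := a :* x :+ b :* (d :* x) :+ c :* (e :* x))
                           refl (X₁ ^ w) (ι c₁) (ι c₂) (ι c₃) (u ^ w) ((ι λ₁ + ι λ₂ * u) ^ w) ⟩
              ι c₁ * X₁ ^ w + ι c₂ * (u ^ w * X₁ ^ w) + ι c₃ * ((ι λ₁ + ι λ₂ * u) ^ w * X₁ ^ w)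
                ≈⟨ +-cong (+-congˡ (*-congˡ (trans (sym (^-distrib-* u X₁ w)) (^-congˡ w (sym X₂≈uX₁)))))
                          (*-congˡ (trans (sym (^-distrib-* _ X₁ w)) (^-congˡ w (sym X₃≈)))) ⟩
              ι c₁ * X₁ ^ w + ι c₂ * X₂ ^ w + ι c₃ * label (vec P₃) ^ w
                ≈⟨ relation≈0 ⟩
              0# ∎))
          where
          X₁ = label (vec P₁)
          X₂ = label (vec P₂)
          X₁≉0 = label-≉0 P₁
          u = X₂ * inv X₁ X₁≉0
          X₂≈uX₁ : X₂ ≈ u * X₁
          X₂≈uX₁ = sym (trans (*-assoc _ _ _) (trans (*-congˡ (inverseˡ X₁ X₁≉0)) (*-identityʳ X₂)))
          X₃≈ : label (vec P₃) ≈ (ι λ₁ + ι λ₂ * u) * X₁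
          X₃≈ = begin
            label (vec P₃)                                       ≈⟨ label-cong P₃≈ ⟩
            label (λ i → λ₁ K.* vec P₁ i K.+ λ₂ K.* vec P₂ i)    ≈⟨ label-+ _ _ ⟩
            label (λ i → λ₁ K.* vec P₁ i) + label (λ i → λ₂ K.* vec P₂ i)
                                                                 ≈⟨ +-cong (label-scale λ₁ (vec P₁)) (label-scale λ₂ (vec P₂)) ⟩
            ι λ₁ * X₁ + ι λ₂ * X₂                                ≈⟨ +-congˡ (*-congˡ X₂≈uX₁) ⟩
            ι λ₁ * X₁ + ι λ₂ * (u * X₁)
              ≈⟨ solve 4 (λ a x b u → a :* x :+ b :* (u :* x) := (a :+ b :* u) :* x) refl (ι λ₁) X₁ (ι λ₂) u ⟩
            (ι λ₁ + ι λ₂ * u) * X₁                               ∎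
          u∉K : ∀ l → u ≉ ι l
          u∉K l u≈ιl = proportional (l K.≟ K.0#)
            where
            P₂≈lP₁ : vec P₂ K.≋ (λ i → l K.* vec P₁ i)
            P₂≈lP₁ = label-injective {vec P₂} {λ i → l K.* vec P₁ i}
              (trans X₂≈uX₁ (trans (*-congʳ u≈ιl) (sym (label-scale l (vec P₁)))))
            proportional : Dec (l K.≈ K.0#) → ⊥
            proportional (yes l≈0) = point-≉0 P₂ (λ i → K.trans (P₂≈lP₁ i) (K.trans (K.*-congʳ l≈0) (K.zeroˡ _)))
            proportional (no  l≉0) = P₁≁P₂ (∼-sym {P₂} {P₁} (l , l≉0 , P₂≈lP₁))

      line-image-is-cap : ∀ a b → ¬ a ∼ b → IsCap (λ Q → ∃ λ P → OnLine a b P ∧ Φ P Q)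
      line-image-is-cap a b _ Q₁ Q₂ Q₃
        (P₁ , (α₁ , β₁ , P₁≈) , φ₁) (P₂ , (α₂ , β₂ , P₂≈) , φ₂) (P₃ , (α₃ , β₃ , P₃≈) , φ₃)
        Q₁≁Q₂ Q₂≁Q₃ Q₁≁Q₃ (a′ , b′ , _ , (s₁ , t₁ , Q₁≈) , (s₂ , t₂ , Q₂≈) , (s₃ , t₃ , Q₃≈)) =
        from-combination (third-point-combination P₁ P₂ P₃ (vec a) (vec b) α₁ β₁ α₂ β₂ α₃ β₃ P₁≈ P₂≈ P₃≈
                            (Q₁≁Q₂ ∘ well-defined P₁ P₂ Q₁ Q₂ φ₁ φ₂)
                            (Q₁≁Q₃ ∘ well-defined P₁ P₃ Q₁ Q₃ φ₁ φ₃)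
                            (Q₂≁Q₃ ∘ well-defined P₂ P₃ Q₂ Q₃ φ₂ φ₃))
        where
        c₁ c₂ c₃ : K.Carrier
        c₁ = s₂ K.* t₃ K.- s₃ K.* t₂
        c₂ = s₃ K.* t₁ K.- s₁ K.* t₃
        c₃ = s₁ K.* t₂ K.- s₂ K.* t₁
        c₃≉0 : c₃ K.≉ K.0#
        c₃≉0 c₃≈0 = Q₁≁Q₂ (det≈0⇒∼ Q₁ Q₂ (vec a′) (vec b′) s₁ t₁ s₂ t₂ Q₁≈ Q₂≈ c₃≈0)
        relation : ι c₁ * label (vec Q₁) + ι c₂ * label (vec Q₂) + ι c₃ * label (vec Q₃) ≈ 0#
        relation = begin
          ι c₁ * label (vec Q₁) + ι c₂ * label (vec Q₂) + ι c₃ * label (vec Q₃)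
            ≈⟨ +-cong (+-cong (label-scale c₁ _) (label-scale c₂ _)) (label-scale c₃ _) ⟨
          label (λ i → c₁ K.* vec Q₁ i) + label (λ i → c₂ K.* vec Q₂ i) + label (λ i → c₃ K.* vec Q₃ i)
            ≈⟨ +-congʳ (label-+ _ _) ⟨
          label (λ i → c₁ K.* vec Q₁ i K.+ c₂ K.* vec Q₂ i) + label (λ i → c₃ K.* vec Q₃ i)
            ≈⟨ label-+ _ _ ⟨
          label (λ i → c₁ K.* vec Q₁ i K.+ c₂ K.* vec Q₂ i K.+ c₃ K.* vec Q₃ i)
            ≈⟨ label-zero _ (collinear-relation Q₁ Q₂ Q₃ (vec a′) (vec b′) s₁ t₁ s₂ t₂ s₃ t₃ Q₁≈ Q₂≈ Q₃≈) ⟩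
          0# ∎
        from-combination : (∃₂ λ λ₁ λ₂ → λ₁ K.≉ K.0# ∧ λ₂ K.≉ K.0# ∧
                              (∀ i → vec P₃ i K.≈ λ₁ K.* vec P₁ i K.+ λ₂ K.* vec P₂ i)) → ⊥
        from-combination (λ₁ , λ₂ , λ₁≉0 , λ₂≉0 , P₃≈λ₁P₁+λ₂P₂) =
          powers-unrelated P₁ P₂ P₃ λ₁ λ₂ λ₁≉0 λ₂≉0 P₃≈λ₁P₁+λ₂P₂ (Q₁≁Q₂ ∘ well-defined P₁ P₂ Q₁ Q₂ φ₁ φ₂)
            c₁ c₂ c₃ c₃≉0
            (trans (sym (+-cong (+-cong (*-congˡ (Φ⇒ P₁ Q₁ φ₁)) (*-congˡ (Φ⇒ P₂ Q₂ φ₂))) (*-congˡ (Φ⇒ P₃ Q₃ φ₃))))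
                   relation)

      isOrthomorphism : IsOrthomorphism Φ
      isOrthomorphism = total , well-defined , injective , surjective , line-image-is-cap

  module Degenerate (z : Carrier) (z-primitive : IsPrimitive F z) (z≈0 : z ≈ 0#) (r≥1 : 1 ℕ.≤ r) where
    open PG K r
    open Labels K F ι z r

    -- Every nonzero element is a power of z ≈ 0, hence equals 1: F = {0, 1}.
    r≡1 : r ≡ 1
    r≡1 = ℕ.≤-antisym (Arithmetic.q^m≤q^n⇒m≤n {n = 1} q≥2
            (ℕ.≤-trans (Fin.injective⇒≤ {f = f} f-injective) (ℕ.≤-trans q≥2 (ℕ.≤-reflexive (≡.sym (ℕ.*-identityʳ q)))))) r≥1
      where
      nonzero≈1 : ∀ x → x ≉ 0# → x ≈ 1#
      nonzero≈1 x x≉0 with z-primitive x x≉0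
      ... | zero  , x≈1     = x≈1
      ... | suc k , x≈z*z^k = ⊥-elim (x≉0 (trans x≈z*z^k (trans (*-congʳ z≈0) (zeroˡ _))))
      f : Fin Q → Fin 2
      f i with F.enum i F.≟ 0#
      ... | yes _ = Fin.zero
      ... | no  _ = Fin.suc Fin.zero
      f-injective : ∀ {i j} → f i ≡ f j → i ≡ j
      f-injective {i} {j} eq with F.enum i F.≟ 0# | F.enum j F.≟ 0#
      ... | yes i≈0 | yes j≈0 = F.enum-injective i j (trans i≈0 (sym j≈0))
      ... | no  i≉0 | no  j≉0 = F.enum-injective i j (trans (nonzero≈1 _ i≉0) (sym (nonzero≈1 _ j≉0)))
      ... | yes _   | no  _   with () ← eq
      ... | no  _   | yes _   with () ← eq

    all-equivalent : ∀ P P′ → P ∼ P′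
    all-equivalent (v , i , vᵢ≉0) (v′ , i′ , v′ᵢ′≉0) =
      t , K.*-≉0 vᵢ≉0 (K.inv-≉0 _ v′ᵢ≉0) ,
      λ j → ≡.subst (λ j → v j K.≈ t K.* v′ j) (Fin-1-unique r≡1 i j) vᵢ≈tv′ᵢ
      where
      Fin-1-unique : ∀ {n} → n ≡ 1 → (i j : Fin n) → i ≡ j
      Fin-1-unique ≡.refl Fin.zero Fin.zero = ≡.refl
      v′ᵢ≉0 : v′ i K.≉ K.0#
      v′ᵢ≉0 = ≡.subst (λ k → v′ k K.≉ K.0#) (Fin-1-unique r≡1 i′ i) v′ᵢ′≉0
      t = v i K.* K.inv (v′ i) v′ᵢ≉0
      vᵢ≈tv′ᵢ : v i K.≈ t K.* v′ i
      vᵢ≈tv′ᵢ = K.sym (K.trans (K.*-assoc _ _ _) (K.trans (K.*-congˡ (K.inverseˡ _ v′ᵢ≉0)) (K.*-identityʳ _)))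

    label≈0 : ∀ v → label v ≈ 0#
    label≈0 v = trans (reflexive (sumFin≡sum r terms))
      (sum-zero terms (λ i → trans (*-congˡ (trans (*-congʳ z≈0) (zeroˡ _))) (zeroʳ _)))
      where
      terms : Fin r → Carrier
      terms i = ι (v i) * pow F z (suc (toℕ i))

    isOrthomorphism : ∀ {w} → 1 ℕ.≤ w → IsOrthomorphism (λ P Q → Lift c (Φgraph w P Q))
    isOrthomorphism {suc w} _ =
        (λ P → P , graph P P)
      , (λ _ _ Q Q′ _ _ _ → all-equivalent Q Q′)
      , (λ P P′ _ _ _ _ _ → all-equivalent P P′)
      , (λ Q → Q , graph Q Q)
      , (λ a b a≁b → ⊥-elim (a≁b (all-equivalent a b)))
      where
      graph : ∀ P Q → Lift c (Φgraph (suc w) P Q)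
      graph P Q = lift (trans (label≈0 (vec Q)) (sym (trans (*-congʳ (label≈0 (vec P))) (zeroˡ _))))

open import Data.Nat using (_≤_; _^_; _∸_; _!)
open import Data.Product using (∃)
open import Relation.Nullary using (¬_)

mainTheorem10 : ∀ {c ℓ : Level} (p e q r w : ℕ) → Prime p → 1 ≤ e → q ≡ p ^ e →
    1 ≤ r → 2 ≤ w → Coprime w (q ^ r ∸ 1) → Coprime r (w !) → ¬ (∃ λ k → w ≡ p ^ k) →
    (K F : CommutativeRing c ℓ) → IsField K → HasCardinality K q →
    IsField F → HasCardinality F (q ^ r) →
    (ι : CommutativeRing.Carrier K → CommutativeRing.Carrier F) →
    RingMorphisms.IsRingHomomorphism (CommutativeRing.rawRing K) (CommutativeRing.rawRing F) ι →
    (z : CommutativeRing.Carrier F) → IsPrimitive F z →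
    PG.IsOrthomorphism K r (λ P Q → Level.Lift c (Labels.Φgraph K F ι z r w P Q))
mainTheorem10 {c} p e q r w pp e≥1 q≡p^e r≥1 w≥2 w⊥q^r-1 r⊥w! w≢p^k
              K F isFieldK cardK isFieldF cardF ι ι-hom z z-primitive =
  by-cases (FiniteRing._≟_ F cardF z (CommutativeRing.0# F))
  where
  q≥2 : 2 ≤ q
  q≥2 = ≡.subst (2 ≤_) (≡.sym q≡p^e) (Arithmetic.prime^e≥2 pp e≥1)
  open FiniteExtension K F isFieldK isFieldF {r = r} cardK cardF q≥2 ι ι-hom
  by-cases : Dec (CommutativeRing._≈_ F z (CommutativeRing.0# F)) →
             PG.IsOrthomorphism K r (λ P Q → Level.Lift c (Labels.Φgraph K F ι z r w P Q))
  by-cases (yes z≈0) = Degenerate.isOrthomorphism z z-primitive z≈0 r≥1 (ℕ.≤-trans (ℕ.s≤s ℕ.z≤n) w≥2)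
  by-cases (no  z≉0) = Primitive.Orthomorphism.isOrthomorphism z z-primitive z≉0 w≥2 w⊥q^r-1 r⊥w! {e = e} pp q≡p^e w≢p^k
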